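{- For every composition $\alpha=(\alpha_1,\dots,\alpha_\ell)$, the antipode $\mathcal{S}$ of $\mathrm{QSym}$ satisfies $\mathcal{S}(S_\alpha)=(-1)^{\ell}S_{(\alpha_\ell,\dots,\alpha_1)}$.
   Context: A composition $\alpha\models n$ is a finite sequence $(\alpha_1,\dots,\alpha_\ell)$ of positive integers with sum $n$. For $\alpha\models n$ let $\mathcal{I}(\alpha)=\{\alpha_1,\alpha_1+\alpha_2,\dots,\alpha_1+\cdots+\alpha_{\ell-1}\}$; write $\beta\leq\alpha$ if $\mathcal{I}(\beta)\subseteq\mathcal{I}(\alpha)$. $\mathrm{QSym}$ is the Hopf algebra of quasisymmetric functions with monomial basis $M_\alpha=\sum_{i_1<\cdots<i_\ell}x_{i_1}^{\alpha_1}\cdots x_{i_\ell}^{\alpha_\ell}$, usual product and deconcatenation coproduct $\Delta(M_\alpha)=\sum_{\beta\gamma=\alpha}M_\beta\otimes M_\gamma$. For $\alpha=(\alpha_1,\dots,\alpha_\ell)$, let $\mathrm{OtE}(\alpha)=\{i:\alpha_i\text{ odd},\alpha_{i+1}\text{ even}\}$; if $\mathrm{OtE}(\alpha)=\{i_1<\cdots<i_k\}$, set $m_o(\alpha)=(\alpha_1+\cdots+\alpha_{i_1},\alpha_{i_1+1}+\cdots+\alpha_{i_2},\dots,\alpha_{i_k+1}+\cdots+\alpha_\ell)$. For $\beta$ with $m_o(\alpha)\leq\beta\leq\alpha$, each $\beta_i=\alpha_j+\cdots+\alpha_{j+k}$; let $\mathrm{O}_\alpha^\beta(i)$, $\mathrm{E}_\alpha^\beta(i)$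 be the numbers of odd and even entries among $\alpha_j,\dots,\alpha_{j+k}$, and $c_\alpha^\beta=\prod_i \frac{1}{\mathrm{O}_\alpha^\beta(i)!\,\mathrm{E}_\alpha^\beta(i)!}$. The shuffle function is $S_\alpha=\sum_{m_o(\alpha)\leq\beta\leq\alpha}c_\alpha^\beta M_\beta$. -}

module Defs where

open import Data.Nat as ℕ using (ℕ; zero; suc; _!; _%_; _≡ᵇ_)
open import Data.Nat.Properties using (_!*_!≢0)
open import Data.Bool using (Bool; true; false; if_then_else_; _∧_)
open import Data.List using (List; []; _∷_; _++_; map; concatMap; length; reverse; filter)
open import Data.List.Properties using (≡-dec)
open import Data.List.Membership.DecPropositional (ℕ._≟_) using (_∈_; _∈?_)
open import Data.List.Relation.Unary.All using (All; all?)
open import Data.Product using (_×_; _,_)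
open import Data.Integer using (+_)
open import Data.Rational using (ℚ; 0ℚ; 1ℚ; _/_; -_) renaming (_+_ to _+ℚ_; _*_ to _*ℚ_)
open import Relation.Nullary using (yes; no)
open import Relation.Nullary.Decidable using (⌊_⌋)
open import Relation.Binary.PropositionalEquality using (_≡_)

-- Compositions are lists of natural numbers (positivity is a separate
-- hypothesis in the theorem).

Composition : Set
Composition = List ℕ

-- I(α) = {α₁, α₁+α₂, …, α₁+⋯+α_{ℓ-1}} (as a list)
Iset : Composition → List ℕ
Iset []            = []
Iset (a ∷ [])      = []
Iset (a ∷ b ∷ r)   = a ∷ map (a ℕ.+_) (Iset (b ∷ r))

_≤c_ : Composition → Composition → Set
β ≤c α = All (_∈ Iset α) (Iset β)

_≤c?_ : Composition → Composition → Bool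
β ≤c? α = ⌊ all? (_∈? Iset α) (Iset β) ⌋

isOdd isEven : ℕ → Bool
isOdd n  = (n % 2) ≡ᵇ 1
isEven n = (n % 2) ≡ᵇ 0

sumℕ : List ℕ → ℕ
sumℕ []      = 0
sumℕ (x ∷ l) = x ℕ.+ sumℕ l

-- Split α into the maximal consecutive blocks obtained by cutting after
-- each position i ∈ OtE(α) (α_i odd, α_{i+1} even).
private
  attach : ℕ → ℕ → List (List ℕ) → List (List ℕ)
  attach a b []       = (a ∷ []) ∷ []          -- unreachable
  attach a b (B ∷ Bs) =
    if isOdd a ∧ isEven b then (a ∷ []) ∷ B ∷ Bs else (a ∷ B) ∷ Bs

otEBlocks : Composition → List (List ℕ)
otEBlocks []          = []
otEBlocks (a ∷ [])    = (a ∷ []) ∷ []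
otEBlocks (a ∷ b ∷ r) = attach a b (otEBlocks (b ∷ r))

mo : Composition → Composition
mo α = map sumℕ (otEBlocks α)

-- All ways of grouping α into consecutive nonempty blocks; each grouping g
-- gives the coarsening β = map sumℕ g, with β_i = α_j + ⋯ + α_{j+k}.
groupings : Composition → List (List (List ℕ))
groupings []      = [] ∷ []
groupings (a ∷ r) = concatMap ext (groupings r)
  where
  ext : List (List ℕ) → List (List (List ℕ))
  ext []       = ((a ∷ []) ∷ []) ∷ []
  ext (B ∷ Bs) = ((a ∷ []) ∷ B ∷ Bs) ∷ ((a ∷ B) ∷ Bs) ∷ []

countOdd countEven : List ℕ → ℕ
countOdd  = λ B → length (filter (λ x → isOdd x Data.Bool.≟ true) B)
countEven = λ B → length (filter (λ x → isEven x Data.Bool.≟ true) B)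

blockCoeff : List ℕ → ℚ
blockCoeff B = ((+ 1) / (countOdd B ! ℕ.* countEven B !))
  {{countOdd B !* countEven B !≢0}}

cCoeff : List (List ℕ) → ℚ
cCoeff []       = 1ℚ
cCoeff (B ∷ Bs) = blockCoeff B *ℚ cCoeff Bs

-- QSym (graded, finite linear combinations) in the monomial basis:
-- an element is a formal ℚ-linear combination  Σ c · M_β  given as a list.

QSymElt : Set
QSymElt = List (ℚ × Composition)

coeff : QSymElt → Composition → ℚ
coeff []            γ = 0ℚ
coeff ((c , β) ∷ f) γ with ≡-dec ℕ._≟_ β γ
... | yes _ = c +ℚ coeff f γ
... | no  _ = coeff f γ

M : Composition → QSymElt
M β = (1ℚ , β) ∷ []

scale : ℚ → QSymElt → QSymElt
scale c = map (λ { (d , β) → (c *ℚ d , β) })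

neg : QSymElt → QSymElt
neg = scale (- 1ℚ)

-- quasi-shuffle (stuffle) of compositions: M_u · M_v = Σ_{w ∈ u ⧢ v} M_w
quasiShuffle : Composition → Composition → List Composition
quasiShuffle []      v       = v ∷ []
quasiShuffle (a ∷ u) []      = (a ∷ u) ∷ []
quasiShuffle (a ∷ u) (b ∷ v) =
  map (a ∷_) (quasiShuffle u (b ∷ v)) ++
  map (b ∷_) (quasiShuffle (a ∷ u) v) ++
  map ((a ℕ.+ b) ∷_) (quasiShuffle u v)

_·_ : QSymElt → QSymElt → QSymElt
f · g = concatMap (λ { (c , u) → concatMap (λ { (d , v) →
          map (λ w → (c *ℚ d , w)) (quasiShuffle u v) }) g }) f

inits : List ℕ → List (List ℕ)
inits []      = [] ∷ []
inits (x ∷ r) = [] ∷ map (x ∷_) (inits r)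

zipWithL : {A B C : Set} → (A → B → C) → List A → List B → List C
zipWithL f (x ∷ xs) (y ∷ ys) = f x y ∷ zipWithL f xs ys
zipWithL f _        _        = []

-- Antipode on M_α, determined by the Hopf-algebra axiom
--   m ∘ (id ⊗ 𝒮) ∘ Δ = η ∘ ε,  Δ(M_α) = Σ_{βγ=α} M_β ⊗ M_γ,
-- i.e. 𝒮(M_∅) = M_∅ and for α ≠ ∅:  𝒮(M_α) = - Σ_{βγ=α, β≠∅} M_β · 𝒮(M_γ).
-- antipodeSuffixes α lists 𝒮(M_{drop k α}) for k = 0, …, ℓ(α).
antipodeSuffixes : Composition → List QSymElt
antipodeSuffixes []      = M [] ∷ []
antipodeSuffixes (a ∷ r) = new ∷ rs
  where
  rs  = antipodeSuffixes r
  -- splits (a ∷ r) = (a ∷ take k r) (drop k r), k = 0 … ℓ(r)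
  new = neg (concatMap (λ x → x)
          (zipWithL (λ p s → M (a ∷ p) · s) (inits r) rs))

antipodeM : Composition → QSymElt
antipodeM α with antipodeSuffixes α
... | s ∷ _ = s
... | []    = []

antipode : QSymElt → QSymElt
antipode = concatMap (λ { (c , β) → scale c (antipodeM β) })

-- Shuffle function  S_α = Σ_{m_o(α) ≤ β ≤ α} c_α^β M_β

shuffleFn : Composition → QSymElt
shuffleFn α = concatMap term (groupings α)
  where
  term : List (List ℕ) → QSymElt
  term g = if mo α ≤c? map sumℕ g then (cCoeff g , map sumℕ g) ∷ [] else []

signℚ : ℕ → ℚ
signℚ zero    = 1ℚ
signℚ (suc n) = - signℚ n

module Submission where

open import Defs
open import Data.Nat using (ℕ; _<_)
open import Data.List using (List; length; reverse)
open import Data.List.Relation.Unary.All using (All)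
open import Data.Rational using (ℚ; _*_)
open import Relation.Binary.PropositionalEquality using (_≡_)

-- Write S_α = Σ_g ε(g) M_{β(g)}, summing over the groupings g of α into blocks of consecutive
-- entries, where β(g) is the composition of block sums and ε(g) the product of the block weights
-- ε(B) = 1 / (#odd B)! (#even B)! if no odd entry of B is followed by an even one, and 0 otherwise
-- (this is the condition m_o(α) ≤ β(g)).  As 𝒮(M_β) = (-1)^ℓ(β) Σ_γ M_{reverse γ} over the
-- coarsenings γ of β, combining the two groupings gives 𝒮(S_α) = Σ_G ψ(G) M_{reverse β(G)},
-- where the weight ψ(B) of a block sums ∏(-ε) over the groupings of B.  For the concatenation
-- product ⊛ of functions on words this says that ψ is the ⊛-inverse of ε.  Now ε = E ⊛ O, where
-- E and O are the exponential series e^x restricted to words with only even, resp. only odd,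
-- entries, whose inverses are the series e^(-x) restricted likewise; hence ψ = O⁻¹ ⊛ E⁻¹, that
-- is ψ(B) = (-1)^|B| ε(reverse B).  Reversing the groupings, this is (-1)^ℓ(α) S_{reverse α}.

open import Data.Bool using (Bool; true; false; not; _∧_; if_then_else_; T; T?)
import Data.Bool.Properties as Bool
open import Data.Bool.ListAction using (all)
open import Data.Empty using (⊥-elim)
import Data.Integer as ℤ
import Data.Integer.Properties as ℤ
open import Data.List using ([]; _∷_; _++_; _∷ʳ_; map; concat; concatMap; filter; tails)
open import Data.List.Membership.Propositional using (_∈_; _∉_)
open import Data.List.Membership.Propositional.Properties using (∈-map⁺; ∈-map⁻)
open import Data.List.Properties
  using (≡-dec; unfold-reverse; reverse-involutive; reverse-map; reverse-++; ++-assoc; map-∘; map-cong;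
         length-map; length-++; length-reverse)
open import Data.List.Relation.Binary.Permutation.Propositional using (↭-sym)
open import Data.List.Relation.Binary.Permutation.Propositional.Properties using (All-resp-↭; ↭-reverse)
open import Data.List.Relation.Unary.All as All using ([]; _∷_)
import Data.List.Relation.Unary.All.Properties as AllP
open import Data.List.Relation.Unary.Any using (here; there)
open import Data.Nat as ℕ using (zero; suc; _!)
import Data.Nat.DivMod as ℕ
open import Data.Nat.ListAction using (sum)
open import Data.Nat.ListAction.Properties using (sum-++; sum-↭)
import Data.Nat.Properties as ℕ
open import Data.List.Membership.DecPropositional ℕ._≟_ using (_∈?_)
open import Data.Product using (_×_; _,_; proj₁; proj₂; ∃₂)
open import Data.Rational using (0ℚ; 1ℚ; _+_; -_; _/_; toℚᵘ)
open import Data.Rational.Properties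
  using (+-identityˡ; +-identityʳ; +-assoc; +-comm; +-inverseʳ; *-identityˡ; *-identityʳ; *-zeroˡ; *-zeroʳ;
         *-assoc; *-comm; *-distribˡ-+; *-distribʳ-+; neg-distrib-+; neg-distribˡ-*; neg-distribʳ-*;
         +-0-group; toℚᵘ-injective; toℚᵘ-fromℚᵘ; toℚᵘ-homo-+; toℚᵘ-homo-*)
open import Algebra.Properties.Group +-0-group using (inverseˡ-unique)
open import Data.Rational.Solver using (module +-*-Solver)
import Data.Rational.Unnormalised as ℚᵘ
import Data.Rational.Unnormalised.Properties as ℚᵘ
open import Function using (_∘_; _⇔_; mk⇔)
open import Function.Properties.Equivalence using () renaming (trans to ⇔-trans)
open import Relation.Binary.PropositionalEquality
  using (_≢_; refl; sym; trans; cong; cong₂; subst; module ≡-Reasoning)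
open import Relation.Nullary using (yes; no)
open import Relation.Nullary.Decidable using (⌊_⌋; isYes≗does; does-⇔)

open +-*-Solver
open ≡-Reasoning

private
  toℚᵘ-/ : ∀ i n .{{_ : ℕ.NonZero n}} → toℚᵘ (i / n) ℚᵘ.≃ (i ℚᵘ./ n)
  toℚᵘ-/ i (suc n) = toℚᵘ-fromℚᵘ (ℚᵘ.mkℚᵘ i n)

/-cross : ∀ i j m n .{{_ : ℕ.NonZero m}} .{{_ : ℕ.NonZero n}} →
          i ℤ.* ℤ.+ n ≡ j ℤ.* ℤ.+ m → i / m ≡ j / n
/-cross i j m@(suc _) n@(suc _) eq =
  toℚᵘ-injective (ℚᵘ.≃-trans (toℚᵘ-/ i m) (ℚᵘ.≃-trans (ℚᵘ.*≡* eq) (ℚᵘ.≃-sym (toℚᵘ-/ j n))))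

/-*-/ : ∀ i j m n .{{_ : ℕ.NonZero m}} .{{_ : ℕ.NonZero n}} →
        (i / m) * (j / n) ≡ ((i ℤ.* j) / (m ℕ.* n)) {{ℕ.m*n≢0 m n}}
/-*-/ i j m@(suc _) n@(suc _) = toℚᵘ-injective (ℚᵘ.≃-trans (toℚᵘ-homo-* (i / m) (j / n))
  (ℚᵘ.≃-trans (ℚᵘ.*-cong (toℚᵘ-/ i m) (toℚᵘ-/ j n)) (ℚᵘ.≃-sym (toℚᵘ-/ (i ℤ.* j) (m ℕ.* n)))))

/-+-/ : ∀ i j m n .{{_ : ℕ.NonZero m}} .{{_ : ℕ.NonZero n}} →
        (i / m) + (j / n) ≡ ((i ℤ.* ℤ.+ n ℤ.+ j ℤ.* ℤ.+ m) / (m ℕ.* n)) {{ℕ.m*n≢0 m n}}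
/-+-/ i j m@(suc _) n@(suc _) = toℚᵘ-injective (ℚᵘ.≃-trans (toℚᵘ-homo-+ (i / m) (j / n))
  (ℚᵘ.≃-trans (ℚᵘ.+-cong (toℚᵘ-/ i m) (toℚᵘ-/ j n)) (ℚᵘ.≃-sym (toℚᵘ-/ _ (m ℕ.* n)))))

fromℕ : ℕ → ℚ
fromℕ n = ℤ.+ n / 1

fromℕ-suc : ∀ n → fromℕ (suc n) ≡ 1ℚ + fromℕ n
fromℕ-suc n = sym (trans (/-+-/ (ℤ.+ 1) (ℤ.+ n) 1 1) (/-cross (ℤ.+ 1 ℤ.* ℤ.+ 1 ℤ.+ ℤ.+ n ℤ.* ℤ.+ 1) (ℤ.+ suc n) 1 1
  (trans (trans (ℤ.*-identityʳ _) (cong (ℤ._+_ (ℤ.+ 1)) (ℤ.*-identityʳ (ℤ.+ n)))) (sym (ℤ.*-identityʳ (ℤ.+ suc n))))))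

fromℕ-*-1/ : ∀ n .{{_ : ℕ.NonZero n}} → fromℕ n * (ℤ.+ 1 / n) ≡ 1ℚ
fromℕ-*-1/ n = trans (/-*-/ (ℤ.+ n) (ℤ.+ 1) 1 n)
  (/-cross (ℤ.+ n ℤ.* ℤ.+ 1) (ℤ.+ 1) (1 ℕ.* n) 1 {{ℕ.m*n≢0 1 n}}
    (trans (trans (ℤ.*-identityʳ _) (ℤ.*-identityʳ (ℤ.+ n)))
           (sym (trans (ℤ.*-identityˡ _) (cong ℤ.+_ (ℕ.*-identityˡ n))))))

module _ {A : Set} where

  ∑ : List A → (A → ℚ) → ℚ
  ∑ []       F = 0ℚ
  ∑ (x ∷ xs) F = F x + ∑ xs F

  -- ∑[ x ∈ xs ] a * b sums a * b, but the bodies of ∑[ x ∈ xs ] a + b and ∏[ x ∈ xs ] a * b end at a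
  infix 6.5 ∑
  syntax ∑ xs (λ x → e) = ∑[ x ∈ xs ] e

  ∏ : List A → (A → ℚ) → ℚ
  ∏ []       φ = 1ℚ
  ∏ (x ∷ xs) φ = φ x * ∏ xs φ

  infix 8 ∏
  syntax ∏ xs (λ x → e) = ∏[ x ∈ xs ] e

  ∑-++ : ∀ xs ys (F : A → ℚ) → ∑ (xs ++ ys) F ≡ ∑ xs F + ∑ ys F
  ∑-++ []       ys F = sym (+-identityˡ _)
  ∑-++ (x ∷ xs) ys F = trans (cong (F x +_) (∑-++ xs ys F)) (sym (+-assoc (F x) _ _))

  ∑-cong : ∀ xs {F G : A → ℚ} → (∀ x → F x ≡ G x) → ∑ xs F ≡ ∑ xs G
  ∑-cong []       F≗G = refl
  ∑-cong (x ∷ xs) F≗G = cong₂ _+_ (F≗G x) (∑-cong xs F≗G)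

  ∑-distrib-+ : ∀ xs (F G : A → ℚ) → ∑[ x ∈ xs ] (F x + G x) ≡ ∑ xs F + ∑ xs G
  ∑-distrib-+ []       F G = refl
  ∑-distrib-+ (x ∷ xs) F G = trans (cong (F x + G x +_) (∑-distrib-+ xs F G))
    (solve 4 (λ a b c d → (a :+ b) :+ (c :+ d) := (a :+ c) :+ (b :+ d)) refl (F x) (G x) (∑ xs F) (∑ xs G))

  *-distribˡ-∑ : ∀ c xs (F : A → ℚ) → c * ∑ xs F ≡ ∑[ x ∈ xs ] (c * F x)
  *-distribˡ-∑ c []       F = *-zeroʳ c
  *-distribˡ-∑ c (x ∷ xs) F = trans (*-distribˡ-+ c (F x) _) (cong (c * F x +_) (*-distribˡ-∑ c xs F))

  *-distribʳ-∑ : ∀ c xs (F : A → ℚ) → ∑ xs F * c ≡ ∑[ x ∈ xs ] (F x * c)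
  *-distribʳ-∑ c xs F =
    trans (*-comm _ c) (trans (*-distribˡ-∑ c xs F) (∑-cong xs (λ x → *-comm c (F x))))

  ∑-zero : ∀ xs → ∑[ x ∈ xs ] 0ℚ ≡ 0ℚ
  ∑-zero []       = refl
  ∑-zero (x ∷ xs) = trans (+-identityˡ _) (∑-zero xs)

  ∏-++ : ∀ xs ys (φ : A → ℚ) → ∏ (xs ++ ys) φ ≡ ∏ xs φ * ∏ ys φ
  ∏-++ []       ys φ = sym (*-identityˡ _)
  ∏-++ (x ∷ xs) ys φ = trans (cong (φ x *_) (∏-++ xs ys φ)) (sym (*-assoc (φ x) _ _))

  ∏-reverse : ∀ xs (φ : A → ℚ) → ∏ (reverse xs) φ ≡ ∏ xs φ
  ∏-reverse []       φ = refl
  ∏-reverse (x ∷ xs) φ = begin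
    ∏ (reverse (x ∷ xs)) φ      ≡⟨ cong (λ ys → ∏ ys φ) (unfold-reverse x xs) ⟩
    ∏ (reverse xs ∷ʳ x) φ       ≡⟨ ∏-++ (reverse xs) (x ∷ []) φ ⟩
    ∏ (reverse xs) φ * (φ x * 1ℚ) ≡⟨ cong₂ _*_ (∏-reverse xs φ) (*-identityʳ (φ x)) ⟩
    ∏ xs φ * φ x                ≡⟨ *-comm _ (φ x) ⟩
    ∏ (x ∷ xs) φ                ∎

  ∏-cong : ∀ xs {φ ψ : A → ℚ} → (∀ x → φ x ≡ ψ x) → ∏ xs φ ≡ ∏ xs ψ
  ∏-cong []       φ≗ψ = refl
  ∏-cong (x ∷ xs) φ≗ψ = cong₂ _*_ (φ≗ψ x) (∏-cong xs φ≗ψ)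

  ∏-distrib-* : ∀ xs (φ ψ : A → ℚ) → ∏[ x ∈ xs ] (φ x * ψ x) ≡ ∏ xs φ * ∏ xs ψ
  ∏-distrib-* []       φ ψ = refl
  ∏-distrib-* (x ∷ xs) φ ψ = trans (cong (φ x * ψ x *_) (∏-distrib-* xs φ ψ))
    (solve 4 (λ a b c d → a :* b :* (c :* d) := a :* c :* (b :* d)) refl (φ x) (ψ x) (∏ xs φ) (∏ xs ψ))

module _ {A B : Set} where

  ∑-map : ∀ (f : A → B) xs (F : B → ℚ) → ∑ (map f xs) F ≡ ∑[ x ∈ xs ] F (f x)
  ∑-map f []       F = refl
  ∑-map f (x ∷ xs) F = cong (F (f x) +_) (∑-map f xs F)

  ∑-concatMap : ∀ (f : A → List B) xs (F : B → ℚ) → ∑ (concatMap f xs) F ≡ ∑[ x ∈ xs ] ∑ (f x) F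
  ∑-concatMap f []       F = refl
  ∑-concatMap f (x ∷ xs) F = trans (∑-++ (f x) (concatMap f xs) F) (cong (∑ (f x) F +_) (∑-concatMap f xs F))

  ∏-map : ∀ (f : A → B) xs (φ : B → ℚ) → ∏ (map f xs) φ ≡ ∏[ x ∈ xs ] φ (f x)
  ∏-map f []       φ = refl
  ∏-map f (x ∷ xs) φ = cong (φ (f x) *_) (∏-map f xs φ)

signℚ-+ : ∀ m n → signℚ (m ℕ.+ n) ≡ signℚ m * signℚ n
signℚ-+ zero    n = sym (*-identityˡ (signℚ n))
signℚ-+ (suc m) n = trans (cong -_ (signℚ-+ m n)) (neg-distribˡ-* (signℚ m) (signℚ n))

𝟙 : Bool → ℚ
𝟙 true  = 1ℚ
𝟙 false = 0ℚ

𝟙-∧ : ∀ b c → 𝟙 (b ∧ c) ≡ 𝟙 b * 𝟙 c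
𝟙-∧ true  c = sym (*-identityˡ (𝟙 c))
𝟙-∧ false c = sym (*-zeroˡ (𝟙 c))

𝟙-all : ∀ {A : Set} (P : A → Bool) xs → 𝟙 (all P xs) ≡ ∏[ x ∈ xs ] 𝟙 (P x)
𝟙-all P []       = refl
𝟙-all P (x ∷ xs) = trans (𝟙-∧ (P x) (all P xs)) (cong (𝟙 (P x) *_) (𝟙-all P xs))

∏-neg : ∀ {A : Set} xs (φ : A → ℚ) → ∏[ x ∈ xs ] (- φ x) ≡ signℚ (length xs) * ∏ xs φ
∏-neg []       φ = sym (*-identityˡ 1ℚ)
∏-neg (x ∷ xs) φ = trans (cong (- φ x *_) (∏-neg xs φ))
  (solve 3 (λ f s p → (:- f) :* (s :* p) := (:- s) :* (f :* p)) refl (φ x) (signℚ (length xs)) (∏ xs φ))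

signℚ-length-concat : ∀ {A : Set} (xss : List (List A)) → signℚ (length (concat xss)) ≡ ∏[ xs ∈ xss ] signℚ (length xs)
signℚ-length-concat []         = refl
signℚ-length-concat (xs ∷ xss) = trans (cong signℚ (length-++ xs))
  (trans (signℚ-+ (length xs) _) (cong (signℚ (length xs) *_) (signℚ-length-concat xss)))

module _ {A : Set} where

  ∑-splits : List A → (List A → List A → ℚ) → ℚ
  ∑-splits []       K = K [] []
  ∑-splits (x ∷ xs) K = K [] (x ∷ xs) + ∑-splits xs (λ p s → K (x ∷ p) s)

  ∑-splits-cong : ∀ xs {K K′ : List A → List A → ℚ} →
                  (∀ p s → p ++ s ≡ xs → K p s ≡ K′ p s) → ∑-splits xs K ≡ ∑-splits xs K′
  ∑-splits-cong []       K≗K′ = K≗K′ [] [] refl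
  ∑-splits-cong (x ∷ xs) K≗K′ =
    cong₂ _+_ (K≗K′ [] (x ∷ xs) refl) (∑-splits-cong xs (λ p s eq → K≗K′ (x ∷ p) s (cong (x ∷_) eq)))

  -- the second parts of the decompositions of xs are the elements of tails xs
  ∑-splits-cong-tails : ∀ xs {P : List A → Set} {K K′ : List A → List A → ℚ} → All P (tails xs) →
                        (∀ p {s} → P s → K p s ≡ K′ p s) → ∑-splits xs K ≡ ∑-splits xs K′
  ∑-splits-cong-tails []       (P[] ∷ [])   K≗K′ = K≗K′ [] P[]
  ∑-splits-cong-tails (x ∷ xs) (Pxs ∷ Ptl) K≗K′ =
    cong₂ _+_ (K≗K′ [] Pxs) (∑-splits-cong-tails xs Ptl (λ p → K≗K′ (x ∷ p)))

  tails-induction : {P : List A → Set} → P [] → (∀ x xs → All P (tails xs) → P (x ∷ xs)) →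
                    ∀ xs → All P (tails xs)
  tails-induction P[] step []       = P[] ∷ []
  tails-induction P[] step (x ∷ xs) = step x xs IH ∷ IH
    where IH = tails-induction P[] step xs

  *-distribˡ-∑-splits : ∀ c xs (K : List A → List A → ℚ) →
                        c * ∑-splits xs K ≡ ∑-splits xs (λ p s → c * K p s)
  *-distribˡ-∑-splits c []       K = refl
  *-distribˡ-∑-splits c (x ∷ xs) K =
    trans (*-distribˡ-+ c _ _) (cong (c * K [] (x ∷ xs) +_) (*-distribˡ-∑-splits c xs (λ p → K (x ∷ p))))

  ∑-splits-distrib-+ : ∀ xs (K K′ : List A → List A → ℚ) →
                       ∑-splits xs (λ p s → K p s + K′ p s) ≡ ∑-splits xs K + ∑-splits xs K′
  ∑-splits-distrib-+ []       K K′ = refl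
  ∑-splits-distrib-+ (x ∷ xs) K K′ =
    trans (cong (K [] (x ∷ xs) + K′ [] (x ∷ xs) +_) (∑-splits-distrib-+ xs (λ p → K (x ∷ p)) (λ p → K′ (x ∷ p))))
      (solve 4 (λ a b c d → (a :+ b) :+ (c :+ d) := (a :+ c) :+ (b :+ d)) refl
        (K [] (x ∷ xs)) (K′ [] (x ∷ xs)) (∑-splits xs (λ p → K (x ∷ p))) (∑-splits xs (λ p → K′ (x ∷ p))))

  ∑-splits-∷ʳ : ∀ xs x (K : List A → List A → ℚ) →
                ∑-splits (xs ∷ʳ x) K ≡ ∑-splits xs (λ p s → K p (s ∷ʳ x)) + K (xs ∷ʳ x) []
  ∑-splits-∷ʳ []       x K = refl
  ∑-splits-∷ʳ (y ∷ xs) x K =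
    trans (cong (K [] (y ∷ xs ∷ʳ x) +_) (∑-splits-∷ʳ xs x (λ p → K (y ∷ p))))
      (sym (+-assoc (K [] (y ∷ xs ∷ʳ x)) _ _))

  ∑-splits-reverse : ∀ xs (K : List A → List A → ℚ) →
                     ∑-splits (reverse xs) K ≡ ∑-splits xs (λ p s → K (reverse s) (reverse p))
  ∑-splits-reverse []       K = refl
  ∑-splits-reverse (x ∷ xs) K = begin
    ∑-splits (reverse (x ∷ xs)) K
      ≡⟨ cong (λ ys → ∑-splits ys K) (unfold-reverse x xs) ⟩
    ∑-splits (reverse xs ∷ʳ x) K
      ≡⟨ ∑-splits-∷ʳ (reverse xs) x K ⟩
    ∑-splits (reverse xs) (λ p s → K p (s ∷ʳ x)) + K (reverse xs ∷ʳ x) []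
      ≡⟨ cong₂ _+_ (∑-splits-reverse xs (λ p s → K p (s ∷ʳ x))) (cong (λ ys → K ys []) (sym (unfold-reverse x xs))) ⟩
    ∑-splits xs (λ p s → K (reverse s) (reverse p ∷ʳ x)) + K (reverse (x ∷ xs)) []
      ≡⟨ +-comm (∑-splits xs (λ p s → K (reverse s) (reverse p ∷ʳ x))) _ ⟩
    K (reverse (x ∷ xs)) [] + ∑-splits xs (λ p s → K (reverse s) (reverse p ∷ʳ x))
      ≡⟨ cong (K (reverse (x ∷ xs)) [] +_) (∑-splits-cong xs (λ p s _ → cong (K (reverse s)) (sym (unfold-reverse x p)))) ⟩
    ∑-splits (x ∷ xs) (λ p s → K (reverse s) (reverse p)) ∎

  neg-distrib-∑-splits : ∀ xs (K : List A → List A → ℚ) → - ∑-splits xs K ≡ ∑-splits xs (λ p s → - K p s)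
  neg-distrib-∑-splits []       K = refl
  neg-distrib-∑-splits (x ∷ xs) K =
    trans (neg-distrib-+ (K [] (x ∷ xs)) _) (cong (- K [] (x ∷ xs) +_) (neg-distrib-∑-splits xs (λ p → K (x ∷ p))))

  ∑-cuts : List A → (List A → List A → ℚ) → ℚ
  ∑-cuts []       K = 0ℚ
  ∑-cuts (x ∷ xs) K = ∑-splits xs (λ p s → K (x ∷ p) s)

  ∑-cuts-cong : ∀ xs {K K′ : List A → List A → ℚ} → (∀ p s → K p s ≡ K′ p s) → ∑-cuts xs K ≡ ∑-cuts xs K′
  ∑-cuts-cong []       K≗K′ = refl
  ∑-cuts-cong (x ∷ xs) K≗K′ = ∑-splits-cong xs (λ p s _ → K≗K′ (x ∷ p) s)

  ∑-cuts-∷ : ∀ x xs (K : List A → List A → ℚ) →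
             ∑-cuts (x ∷ xs) K ≡ K (x ∷ []) xs + ∑-cuts xs (λ p s → K (x ∷ p) s)
  ∑-cuts-∷ x []       K = sym (+-identityʳ _)
  ∑-cuts-∷ x (y ∷ xs) K = refl

  ∑-cuts-distrib-+ : ∀ xs (K K′ : List A → List A → ℚ) →
                     ∑-cuts xs (λ p s → K p s + K′ p s) ≡ ∑-cuts xs K + ∑-cuts xs K′
  ∑-cuts-distrib-+ []       K K′ = sym (+-identityʳ 0ℚ)
  ∑-cuts-distrib-+ (x ∷ xs) K K′ = ∑-splits-distrib-+ xs (λ p → K (x ∷ p)) (λ p → K′ (x ∷ p))

module _ {A B : Set} where

  ∑-splits-map : ∀ (f : A → B) xs (K : List B → List B → ℚ) →
                 ∑-splits (map f xs) K ≡ ∑-splits xs (λ p s → K (map f p) (map f s))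
  ∑-splits-map f []       K = refl
  ∑-splits-map f (x ∷ xs) K = cong (K [] (f x ∷ map f xs) +_) (∑-splits-map f xs (λ p → K (f x ∷ p)))

-- Convolution of functions on words

module _ {A : Set} where

  infixl 7 _⊛_

  _⊛_ : (List A → ℚ) → (List A → ℚ) → List A → ℚ
  (F ⊛ G) xs = ∑-splits xs (λ p s → F p * G s)

  δ : List A → ℚ
  δ []      = 1ℚ
  δ (_ ∷ _) = 0ℚ

  ⊛-cong : ∀ {F F′ G G′ : List A → ℚ} → (∀ p → F p ≡ F′ p) → (∀ s → G s ≡ G′ s) →
           ∀ xs → (F ⊛ G) xs ≡ (F′ ⊛ G′) xs
  ⊛-cong F≗F′ G≗G′ xs = ∑-splits-cong xs (λ p s _ → cong₂ _*_ (F≗F′ p) (G≗G′ s))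

  δ-⊛ : ∀ G xs → (δ ⊛ G) xs ≡ G xs
  δ-⊛ G []       = *-identityˡ (G [])
  δ-⊛ G (x ∷ xs) = begin
    1ℚ * G (x ∷ xs) + ∑-splits xs (λ p s → 0ℚ * G s)
      ≡⟨ cong₂ _+_ (*-identityˡ (G (x ∷ xs))) (sym (*-distribˡ-∑-splits 0ℚ xs (λ _ → G))) ⟩
    G (x ∷ xs) + 0ℚ * ∑-splits xs (λ _ → G)          ≡⟨ cong (G (x ∷ xs) +_) (*-zeroˡ (∑-splits xs (λ _ → G))) ⟩
    G (x ∷ xs) + 0ℚ                                   ≡⟨ +-identityʳ _ ⟩
    G (x ∷ xs)                                        ∎

  ⊛-assoc : ∀ F G H xs → ((F ⊛ G) ⊛ H) xs ≡ (F ⊛ (G ⊛ H)) xs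
  ⊛-assoc F G H []       = *-assoc (F []) (G []) (H [])
  ⊛-assoc F G H (x ∷ xs) = begin
    F [] * G [] * H (x ∷ xs) + ∑-splits xs (λ p s → (F [] * G (x ∷ p) + (Fₓ ⊛ G) p) * H s)
      ≡⟨ cong (F [] * G [] * H (x ∷ xs) +_) (trans
           (∑-splits-cong xs (λ p s _ → trans (*-distribʳ-+ (H s) (F [] * Gₓ p) ((Fₓ ⊛ G) p))
                                               (cong (_+ (Fₓ ⊛ G) p * H s) (*-assoc (F []) (Gₓ p) (H s)))))
           (∑-splits-distrib-+ xs _ _)) ⟩
    F [] * G [] * H (x ∷ xs) + (∑-splits xs (λ p s → F [] * (Gₓ p * H s)) + ((Fₓ ⊛ G) ⊛ H) xs)
      ≡⟨ cong₂ (λ a b → F [] * G [] * H (x ∷ xs) + (a + b))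
               (sym (*-distribˡ-∑-splits (F []) xs _)) (⊛-assoc Fₓ G H xs) ⟩
    F [] * G [] * H (x ∷ xs) + (F [] * (Gₓ ⊛ H) xs + (Fₓ ⊛ (G ⊛ H)) xs)
      ≡⟨ solve 5 (λ f g h a b → f :* g :* h :+ (f :* a :+ b) := f :* (g :* h :+ a) :+ b) refl
           (F []) (G []) (H (x ∷ xs)) ((Gₓ ⊛ H) xs) ((Fₓ ⊛ (G ⊛ H)) xs) ⟩
    F [] * (G ⊛ H) (x ∷ xs) + (Fₓ ⊛ (G ⊛ H)) xs ∎
    where
    Fₓ Gₓ : List A → ℚ
    Fₓ p = F (x ∷ p)
    Gₓ p = G (x ∷ p)

  ⊛-reverse : ∀ F G xs → (F ⊛ G) (reverse xs) ≡ ((G ∘ reverse) ⊛ (F ∘ reverse)) xs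
  ⊛-reverse F G xs =
    trans (∑-splits-reverse xs _) (∑-splits-cong xs (λ p s _ → *-comm (F (reverse s)) (G (reverse p))))

  ⊛-sign : ∀ F G xs → ((λ p → signℚ (length p) * F p) ⊛ (λ s → signℚ (length s) * G s)) xs
                      ≡ signℚ (length xs) * (F ⊛ G) xs
  ⊛-sign F G xs = trans (∑-splits-cong xs signs) (sym (*-distribˡ-∑-splits (signℚ (length xs)) xs _))
    where
    signs : ∀ p s → p ++ s ≡ xs →
            signℚ (length p) * F p * (signℚ (length s) * G s) ≡ signℚ (length xs) * (F p * G s)
    signs p s refl = begin
      signℚ (length p) * F p * (signℚ (length s) * G s)
        ≡⟨ solve 4 (λ a b c d → a :* b :* (c :* d) := a :* c :* (b :* d)) refl
                   (signℚ (length p)) (F p) (signℚ (length s)) (G s) ⟩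
      signℚ (length p) * signℚ (length s) * (F p * G s)
        ≡⟨ cong (_* (F p * G s)) (sym (signℚ-+ (length p) (length s))) ⟩
      signℚ (length p ℕ.+ length s) * (F p * G s)
        ≡⟨ cong (λ n → signℚ n * (F p * G s)) (sym (length-++ p)) ⟩
      signℚ (length (p ++ s)) * (F p * G s)                  ∎

  ⊛-scaleˡ : ∀ c (F G : List A → ℚ) xs → ((λ p → c * F p) ⊛ G) xs ≡ c * (F ⊛ G) xs
  ⊛-scaleˡ c F G xs = trans (∑-splits-cong xs (λ p s _ → *-assoc c (F p) (G s))) (sym (*-distribˡ-∑-splits c xs _))

-- The exponential series

infixl 7 _⊙_

_⊙_ : (ℕ → ℚ) → (ℕ → ℚ) → ℕ → ℚ
(a ⊙ c) zero    = a 0 * c 0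
(a ⊙ c) (suc n) = a 0 * c (suc n) + ((a ∘ suc) ⊙ c) n

⊙-cong : ∀ {a a′ c c′ : ℕ → ℚ} → (∀ i → a i ≡ a′ i) → (∀ j → c j ≡ c′ j) →
         ∀ n → (a ⊙ c) n ≡ (a′ ⊙ c′) n
⊙-cong a≗a′ c≗c′ zero    = cong₂ _*_ (a≗a′ 0) (c≗c′ 0)
⊙-cong a≗a′ c≗c′ (suc n) = cong₂ _+_ (cong₂ _*_ (a≗a′ 0) (c≗c′ (suc n))) (⊙-cong (a≗a′ ∘ suc) c≗c′ n)

⊙-distribʳ-+ : ∀ (a a′ c : ℕ → ℚ) n → ((λ i → a i + a′ i) ⊙ c) n ≡ (a ⊙ c) n + (a′ ⊙ c) n
⊙-distribʳ-+ a a′ c zero    = *-distribʳ-+ (c 0) (a 0) (a′ 0)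
⊙-distribʳ-+ a a′ c (suc n) = trans (cong ((a 0 + a′ 0) * c (suc n) +_) (⊙-distribʳ-+ (a ∘ suc) (a′ ∘ suc) c n))
  (solve 5 (λ x x′ y z z′ → (x :+ x′) :* y :+ (z :+ z′) := x :* y :+ z :+ (x′ :* y :+ z′)) refl
    (a 0) (a′ 0) (c (suc n)) (((a ∘ suc) ⊙ c) n) (((a′ ∘ suc) ⊙ c) n))

⊙-negʳ : ∀ (a c : ℕ → ℚ) n → (a ⊙ (λ j → - c j)) n ≡ - (a ⊙ c) n
⊙-negʳ a c zero    = sym (neg-distribʳ-* (a 0) (c 0))
⊙-negʳ a c (suc n) = trans (cong (a 0 * - c (suc n) +_) (⊙-negʳ (a ∘ suc) c n))
  (solve 3 (λ x y z → x :* (:- y) :+ (:- z) := :- (x :* y :+ z)) refl (a 0) (c (suc n)) (((a ∘ suc) ⊙ c) n))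

∂ : (ℕ → ℚ) → ℕ → ℚ
∂ a j = fromℕ (suc j) * a (suc j)

∂-∘suc : ∀ a j → ∂ a (suc j) ≡ ∂ (a ∘ suc) j + a (suc (suc j))
∂-∘suc a j = begin
  fromℕ (suc (suc j)) * a (suc (suc j))          ≡⟨ cong (_* a (suc (suc j))) (fromℕ-suc (suc j)) ⟩
  (1ℚ + fromℕ (suc j)) * a (suc (suc j))
    ≡⟨ solve 2 (λ x y → (con 1ℚ :+ x) :* y := x :* y :+ y) refl (fromℕ (suc j)) (a (suc (suc j))) ⟩
  fromℕ (suc j) * a (suc (suc j)) + a (suc (suc j)) ∎

∂-⊙ : ∀ n (a c : ℕ → ℚ) → fromℕ (suc n) * (a ⊙ c) (suc n) ≡ (∂ a ⊙ c) n + (a ⊙ ∂ c) n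
∂-⊙ zero    a c =
  solve 4 (λ a₀ a₁ c₀ c₁ → con 1ℚ :* (a₀ :* c₁ :+ a₁ :* c₀) := con 1ℚ :* a₁ :* c₀ :+ a₀ :* (con 1ℚ :* c₁))
    refl (a 0) (a 1) (c 0) (c 1)
∂-⊙ (suc n) a c = begin
  fromℕ (2 ℕ.+ n) * (a 0 * c (2 ℕ.+ n) + (a′ ⊙ c) (suc n))
    ≡⟨ *-distribˡ-+ (fromℕ (2 ℕ.+ n)) _ _ ⟩
  fromℕ (2 ℕ.+ n) * (a 0 * c (2 ℕ.+ n)) + fromℕ (2 ℕ.+ n) * (a′ ⊙ c) (suc n)
    ≡⟨ cong (λ q → fromℕ (2 ℕ.+ n) * (a 0 * c (2 ℕ.+ n)) + q * (a′ ⊙ c) (suc n)) (fromℕ-suc (suc n)) ⟩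
  fromℕ (2 ℕ.+ n) * (a 0 * c (2 ℕ.+ n)) + (1ℚ + fromℕ (suc n)) * (a′ ⊙ c) (suc n)
    ≡⟨ cong (fromℕ (2 ℕ.+ n) * (a 0 * c (2 ℕ.+ n)) +_)
         (trans (*-distribʳ-+ ((a′ ⊙ c) (suc n)) 1ℚ (fromℕ (suc n)))
                (cong₂ _+_ (*-identityˡ ((a′ ⊙ c) (suc n))) (∂-⊙ n a′ c))) ⟩
  fromℕ (2 ℕ.+ n) * (a 0 * c (2 ℕ.+ n)) + ((a′ ⊙ c) (suc n) + ((∂ a′ ⊙ c) n + (a′ ⊙ ∂ c) n))
    ≡⟨ solve 8 (λ f a₀ c₂ a₁ c₁ x y z → f :* (a₀ :* c₂) :+ ((a₁ :* c₁ :+ x) :+ (y :+ z))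
                  := (con 1ℚ :* a₁ :* c₁ :+ (y :+ x)) :+ (a₀ :* (f :* c₂) :+ z)) refl
         (fromℕ (2 ℕ.+ n)) (a 0) (c (2 ℕ.+ n)) (a 1) (c (suc n))
         ((a′ ∘ suc ⊙ c) n) ((∂ a′ ⊙ c) n) ((a′ ⊙ ∂ c) n) ⟩
  (∂ a 0 * c (suc n) + ((∂ a′ ⊙ c) n + ((a′ ∘ suc) ⊙ c) n)) + (a 0 * ∂ c (suc n) + (a′ ⊙ ∂ c) n)
    ≡⟨ cong (λ q → (∂ a 0 * c (suc n) + q) + (a 0 * ∂ c (suc n) + (a′ ⊙ ∂ c) n))
         (sym (trans (⊙-cong (∂-∘suc a) (λ _ → refl) n) (⊙-distribʳ-+ (∂ a′) (a′ ∘ suc) c n))) ⟩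
  (∂ a ⊙ c) (suc n) + (a ⊙ ∂ c) (suc n) ∎
  where
  a′ : ℕ → ℚ
  a′ = a ∘ suc

e⁺ e⁻ : ℕ → ℚ
e⁺ n = (ℤ.+ 1 / n !) {{ℕ._!≢0 n}}
e⁻ n = signℚ n * e⁺ n

∂e⁺ : ∀ j → ∂ e⁺ j ≡ e⁺ j
∂e⁺ j = begin
  fromℕ (suc j) * e⁺ (suc j)
    ≡⟨ cong (fromℕ (suc j) *_) (sym (/-*-/ (ℤ.+ 1) (ℤ.+ 1) (suc j) (j !) {{_}} {{ℕ._!≢0 j}})) ⟩
  fromℕ (suc j) * ((ℤ.+ 1 / suc j) * e⁺ j)          ≡⟨ sym (*-assoc (fromℕ (suc j)) _ (e⁺ j)) ⟩
  fromℕ (suc j) * (ℤ.+ 1 / suc j) * e⁺ j            ≡⟨ cong (_* e⁺ j) (fromℕ-*-1/ (suc j)) ⟩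
  1ℚ * e⁺ j                                         ≡⟨ *-identityˡ (e⁺ j) ⟩
  e⁺ j                                              ∎

∂e⁻ : ∀ j → ∂ e⁻ j ≡ - e⁻ j
∂e⁻ j = begin
  fromℕ (suc j) * (- signℚ j * e⁺ (suc j))      ≡⟨ solve 3 (λ f s e → f :* ((:- s) :* e) := :- (s :* (f :* e))) refl
                                                     (fromℕ (suc j)) (signℚ j) (e⁺ (suc j)) ⟩
  - (signℚ j * (fromℕ (suc j) * e⁺ (suc j)))   ≡⟨ cong (λ q → - (signℚ j * q)) (∂e⁺ j) ⟩
  - e⁻ j                                        ∎

e⁺⊙e⁻ : ∀ n → (e⁺ ⊙ e⁻) (suc n) ≡ 0ℚ
e⁺⊙e⁻ n = begin
  X                                            ≡⟨ sym (*-identityˡ X) ⟩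
  1ℚ * X
    ≡⟨ cong (_* X) (sym (trans (*-comm _ (fromℕ (suc n))) (fromℕ-*-1/ (suc n)))) ⟩
  (ℤ.+ 1 / suc n) * fromℕ (suc n) * X          ≡⟨ *-assoc (ℤ.+ 1 / suc n) (fromℕ (suc n)) X ⟩
  (ℤ.+ 1 / suc n) * (fromℕ (suc n) * X)        ≡⟨ cong ((ℤ.+ 1 / suc n) *_) derivative-vanishes ⟩
  (ℤ.+ 1 / suc n) * 0ℚ                         ≡⟨ *-zeroʳ (ℤ.+ 1 / suc n) ⟩
  0ℚ                                           ∎
  where
  X = (e⁺ ⊙ e⁻) (suc n)
  derivative-vanishes : fromℕ (suc n) * X ≡ 0ℚ
  derivative-vanishes = begin
    fromℕ (suc n) * X                           ≡⟨ ∂-⊙ n e⁺ e⁻ ⟩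
    (∂ e⁺ ⊙ e⁻) n + (e⁺ ⊙ ∂ e⁻) n
      ≡⟨ cong₂ _+_ (⊙-cong ∂e⁺ (λ _ → refl) n) (trans (⊙-cong (λ _ → refl) ∂e⁻ n) (⊙-negʳ e⁺ e⁻ n)) ⟩
    (e⁺ ⊙ e⁻) n + - (e⁺ ⊙ e⁻) n                ≡⟨ +-inverseʳ ((e⁺ ⊙ e⁻) n) ⟩
    0ℚ                                          ∎

module _ {A : Set} where

  count : (A → Bool) → List A → ℕ
  count P []       = 0
  count P (x ∷ xs) = if P x then suc (count P xs) else count P xs

  sortedBy : (A → Bool) → List A → Bool
  sortedBy P []       = true
  sortedBy P (x ∷ xs) = if P x then sortedBy P xs else all (not ∘ P) xs

  uniform : (A → Bool) → (ℕ → ℚ) → List A → ℚ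
  uniform P a xs = 𝟙 (all P xs) * a (length xs)

  sortedBy-[x] : ∀ (P : A → Bool) x → sortedBy P (x ∷ []) ≡ true
  sortedBy-[x] P x with P x
  ... | true  = refl
  ... | false = refl

  sortedBy-∷-∷ : ∀ (P : A → Bool) x y xs → sortedBy P (x ∷ y ∷ xs) ≡ not (not (P x) ∧ P y) ∧ sortedBy P (y ∷ xs)
  sortedBy-∷-∷ P x y xs with P x | P y
  ... | true  | _     = refl
  ... | false | true  = refl
  ... | false | false = refl

  count-all : ∀ (P : A → Bool) xs → all P xs ≡ true → count P xs ≡ length xs
  count-all P []       _ = refl
  count-all P (x ∷ xs) h with P x
  ... | true = cong suc (count-all P xs h)

  count-all-not : ∀ (P : A → Bool) xs → all (not ∘ P) xs ≡ true → count P xs ≡ 0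
  count-all-not P []       _ = refl
  count-all-not P (x ∷ xs) h with P x
  ... | false = count-all-not P xs h

  all-++ : ∀ (P : A → Bool) xs ys → all P (xs ++ ys) ≡ all P xs ∧ all P ys
  all-++ P []       ys = refl
  all-++ P (x ∷ xs) ys = trans (cong (P x ∧_) (all-++ P xs ys)) (sym (Bool.∧-assoc (P x) _ _))

  all-reverse : ∀ (P : A → Bool) xs → all P (reverse xs) ≡ all P xs
  all-reverse P []       = refl
  all-reverse P (x ∷ xs) = begin
    all P (reverse (x ∷ xs))        ≡⟨ cong (all P) (unfold-reverse x xs) ⟩
    all P (reverse xs ∷ʳ x)         ≡⟨ all-++ P (reverse xs) (x ∷ []) ⟩
    all P (reverse xs) ∧ (P x ∧ true) ≡⟨ cong₂ _∧_ (all-reverse P xs) (Bool.∧-identityʳ (P x)) ⟩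
    all P xs ∧ P x                  ≡⟨ Bool.∧-comm (all P xs) (P x) ⟩
    all P (x ∷ xs)                  ∎

  uniform-∷ : ∀ (P : A → Bool) a x xs → uniform P a (x ∷ xs) ≡ 𝟙 (P x) * uniform P (a ∘ suc) xs
  uniform-∷ P a x xs = trans (cong (_* a (suc (length xs))) (𝟙-∧ (P x) (all P xs))) (*-assoc (𝟙 (P x)) _ _)

  uniform-reverse : ∀ (P : A → Bool) a xs → uniform P a (reverse xs) ≡ uniform P a xs
  uniform-reverse P a xs = cong₂ (λ b n → 𝟙 b * a n) (all-reverse P xs) (length-reverse xs)

  uniform-⊛-uniform : ∀ (P : A → Bool) a c xs → (uniform P a ⊛ uniform P c) xs ≡ 𝟙 (all P xs) * (a ⊙ c) (length xs)
  uniform-⊛-uniform P a c []       = solve 2 (λ x y → (con 1ℚ :* x) :* (con 1ℚ :* y) := con 1ℚ :* (x :* y)) refl (a 0) (c 0)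
  uniform-⊛-uniform P a c (x ∷ xs) = begin
    uniform P a [] * uniform P c (x ∷ xs) + ((λ p → uniform P a (x ∷ p)) ⊛ uniform P c) xs
      ≡⟨ cong₂ _+_ (cong (uniform P a [] *_) (uniform-∷ P c x xs))
                   (trans (⊛-cong (uniform-∷ P a x) (λ _ → refl) xs) (⊛-scaleˡ (𝟙 (P x)) _ _ xs)) ⟩
    (1ℚ * a 0) * (𝟙 (P x) * uniform P (c ∘ suc) xs) + 𝟙 (P x) * (uniform P (a ∘ suc) ⊛ uniform P c) xs
      ≡⟨ cong (λ q → (1ℚ * a 0) * (𝟙 (P x) * uniform P (c ∘ suc) xs) + 𝟙 (P x) * q)
              (uniform-⊛-uniform P (a ∘ suc) c xs) ⟩
    (1ℚ * a 0) * (𝟙 (P x) * (𝟙 (all P xs) * c (suc (length xs)))) + 𝟙 (P x) * (𝟙 (all P xs) * ((a ∘ suc) ⊙ c) (length xs))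
      ≡⟨ solve 5 (λ a₀ p q c₁ r → (con 1ℚ :* a₀) :* (p :* (q :* c₁)) :+ p :* (q :* r)
                                  := (p :* q) :* (a₀ :* c₁ :+ r)) refl
           (a 0) (𝟙 (P x)) (𝟙 (all P xs)) (c (suc (length xs))) (((a ∘ suc) ⊙ c) (length xs)) ⟩
    𝟙 (P x) * 𝟙 (all P xs) * (a ⊙ c) (suc (length xs))
      ≡⟨ cong (_* (a ⊙ c) (suc (length xs))) (sym (𝟙-∧ (P x) (all P xs))) ⟩
    𝟙 (all P (x ∷ xs)) * (a ⊙ c) (length (x ∷ xs)) ∎

  uniform-⊛-uniform-not : ∀ (P : A → Bool) a c xs →
    (uniform P a ⊛ uniform (not ∘ P) c) xs ≡ 𝟙 (sortedBy P xs) * a (count P xs) * c (count (not ∘ P) xs)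
  uniform-⊛-uniform-not P a c []       =
    solve 2 (λ x y → (con 1ℚ :* x) :* (con 1ℚ :* y) := con 1ℚ :* x :* y) refl (a 0) (c 0)
  uniform-⊛-uniform-not P a c (x ∷ xs) = begin
    uniform P a [] * uniform (not ∘ P) c (x ∷ xs) + ((λ p → uniform P a (x ∷ p)) ⊛ uniform (not ∘ P) c) xs
      ≡⟨ cong₂ _+_ (cong (uniform P a [] *_) (uniform-∷ (not ∘ P) c x xs))
                   (trans (⊛-cong (uniform-∷ P a x) (λ _ → refl) xs) (⊛-scaleˡ (𝟙 (P x)) _ _ xs)) ⟩
    (1ℚ * a 0) * (𝟙 (not (P x)) * U) + 𝟙 (P x) * (uniform P (a ∘ suc) ⊛ uniform (not ∘ P) c) xs
      ≡⟨ cong (λ q → (1ℚ * a 0) * (𝟙 (not (P x)) * U) + 𝟙 (P x) * q) (uniform-⊛-uniform-not P (a ∘ suc) c xs) ⟩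
    (1ℚ * a 0) * (𝟙 (not (P x)) * U) + 𝟙 (P x) * R
      ≡⟨ by-cases (P x) ⟩
    𝟙 (sortedBy P (x ∷ xs)) * a (count P (x ∷ xs)) * c (count (not ∘ P) (x ∷ xs)) ∎
    where
    U = 𝟙 (all (not ∘ P) xs) * c (suc (length xs))
    R = 𝟙 (sortedBy P xs) * a (suc (count P xs)) * c (count (not ∘ P) xs)
    by-cases : ∀ b → (1ℚ * a 0) * (𝟙 (not b) * U) + 𝟙 b * R
                     ≡ 𝟙 (if b then sortedBy P xs else all (not ∘ P) xs) * a (if b then suc (count P xs) else count P xs)
                       * c (if not b then suc (count (not ∘ P) xs) else count (not ∘ P) xs)
    by-cases true  = solve 3 (λ a₀ u r → (con 1ℚ :* a₀) :* (con 0ℚ :* u) :+ con 1ℚ :* r := r) refl (a 0) U R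
    by-cases false with all (not ∘ P) xs in all-not
    ... | true  = trans (solve 3 (λ a₀ c₁ r → (con 1ℚ :* a₀) :* (con 1ℚ :* (con 1ℚ :* c₁)) :+ con 0ℚ :* r
                                               := con 1ℚ :* a₀ :* c₁) refl (a 0) (c (suc (length xs))) R)
                        (cong₂ (λ i j → 1ℚ * a i * c (suc j))
                               (sym (count-all-not P xs all-not)) (sym (count-all (not ∘ P) xs all-not)))
    ... | false = solve 5 (λ a₀ c₁ r a′ c′ → (con 1ℚ :* a₀) :* (con 1ℚ :* (con 0ℚ :* c₁)) :+ con 0ℚ :* r
                                              := con 0ℚ :* a′ :* c′) refl
                    (a 0) (c (suc (length xs))) R (a (count P xs)) (c (suc (count (not ∘ P) xs)))

  uniform-e⁻ : ∀ (P : A → Bool) xs → uniform P e⁻ xs ≡ signℚ (length xs) * uniform P e⁺ xs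
  uniform-e⁻ P xs = solve 3 (λ b s e → b :* (s :* e) := s :* (b :* e)) refl (𝟙 (all P xs)) (signℚ (length xs)) (e⁺ (length xs))

  uniform-e⁺-⊛-e⁻ : ∀ (P : A → Bool) xs → (uniform P e⁺ ⊛ uniform P e⁻) xs ≡ δ xs
  uniform-e⁺-⊛-e⁻ P []       = refl
  uniform-e⁺-⊛-e⁻ P (x ∷ xs) = begin
    (uniform P e⁺ ⊛ uniform P e⁻) (x ∷ xs)                  ≡⟨ uniform-⊛-uniform P e⁺ e⁻ (x ∷ xs) ⟩
    𝟙 (all P (x ∷ xs)) * (e⁺ ⊙ e⁻) (suc (length xs))       ≡⟨ cong (𝟙 (all P (x ∷ xs)) *_) (e⁺⊙e⁻ (length xs)) ⟩
    𝟙 (all P (x ∷ xs)) * 0ℚ                                 ≡⟨ *-zeroʳ (𝟙 (all P (x ∷ xs))) ⟩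
    0ℚ                                                       ∎

-- Groupings of a composition

sums : List (List ℕ) → Composition
sums = map sumℕ

extend : ℕ → List (List ℕ) → List (List (List ℕ))
extend a []       = ((a ∷ []) ∷ []) ∷ []
extend a (B ∷ Bs) = ((a ∷ []) ∷ B ∷ Bs) ∷ ((a ∷ B) ∷ Bs) ∷ []

∑-groupings-∷ : ∀ a r (F : List (List ℕ) → ℚ) → ∑ (groupings (a ∷ r)) F ≡ ∑[ g ∈ groupings r ] ∑ (extend a g) F
∑-groupings-∷ a r F = trans (∑-concatMap _ (groupings r) F) (∑-cong (groupings r) λ { [] → refl ; (B ∷ Bs) → refl })

data Grouping : Composition → List (List ℕ) → Set where
  []   : Grouping [] []
  new  : ∀ {a α g} → Grouping α g → Grouping (a ∷ α) ((a ∷ []) ∷ g)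
  join : ∀ {a α B g} → Grouping α (B ∷ g) → Grouping (a ∷ α) ((a ∷ B) ∷ g)

∑-cong-groupings : ∀ α {F G : List (List ℕ) → ℚ} → (∀ g → Grouping α g → F g ≡ G g) →
                   ∑ (groupings α) F ≡ ∑ (groupings α) G
∑-cong-groupings []      F≗G = cong (_+ 0ℚ) (F≗G [] [])
∑-cong-groupings (a ∷ r) {F} {G} F≗G =
  trans (∑-groupings-∷ a r F) (trans (∑-cong-groupings r extend-cong) (sym (∑-groupings-∷ a r G)))
  where
  extend-cong : ∀ g → Grouping r g → ∑ (extend a g) F ≡ ∑ (extend a g) G
  extend-cong []       gr = cong (_+ 0ℚ) (F≗G _ (new gr))
  extend-cong (B ∷ Bs) gr = cong₂ _+_ (F≗G _ (new gr)) (cong (_+ 0ℚ) (F≗G _ (join gr)))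

Grouping-concat : ∀ {α g} → Grouping α g → concat g ≡ α
Grouping-concat []        = refl
Grouping-concat (new gr)  = cong (_ ∷_) (Grouping-concat gr)
Grouping-concat (join gr) = cong (_ ∷_) (Grouping-concat gr)

sumℕ≗sum : ∀ xs → sumℕ xs ≡ sum xs
sumℕ≗sum []       = refl
sumℕ≗sum (x ∷ xs) = cong (x ℕ.+_) (sumℕ≗sum xs)

sumℕ-++ : ∀ xs ys → sumℕ (xs ++ ys) ≡ sumℕ xs ℕ.+ sumℕ ys
sumℕ-++ xs ys = trans (sumℕ≗sum (xs ++ ys)) (trans (sum-++ xs ys) (sym (cong₂ ℕ._+_ (sumℕ≗sum xs) (sumℕ≗sum ys))))

sumℕ-reverse : ∀ xs → sumℕ (reverse xs) ≡ sumℕ xs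
sumℕ-reverse xs = trans (sumℕ≗sum (reverse xs)) (trans (sum-↭ (↭-reverse xs)) (sym (sumℕ≗sum xs)))

Grouping-sum : ∀ {α g} → Grouping α g → sumℕ (sums g) ≡ sumℕ α
Grouping-sum {g = g} gr = trans (sumℕ-sums g) (cong sumℕ (Grouping-concat gr))
  where
  sumℕ-sums : ∀ g → sumℕ (sums g) ≡ sumℕ (concat g)
  sumℕ-sums []      = refl
  sumℕ-sums (B ∷ g) = trans (cong (sumℕ B ℕ.+_) (sumℕ-sums g)) (sym (sumℕ-++ B (concat g)))

∑-groupings-firstBlock : ∀ a r (F : List (List ℕ) → ℚ) →
                         ∑ (groupings (a ∷ r)) F ≡ ∑-splits r (λ p s → ∑[ g ∈ groupings s ] F ((a ∷ p) ∷ g))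
∑-groupings-firstBlock a []      F = refl
∑-groupings-firstBlock a (b ∷ r) F = begin
  ∑ (groupings (a ∷ b ∷ r)) F
    ≡⟨ ∑-groupings-∷ a (b ∷ r) F ⟩
  ∑[ g ∈ groupings (b ∷ r) ] ∑ (extend a g) F
    ≡⟨ trans (∑-cong (groupings (b ∷ r)) extend-split) (∑-distrib-+ (groupings (b ∷ r)) _ _) ⟩
  ∑[ g ∈ groupings (b ∷ r) ] F ((a ∷ []) ∷ g) + ∑ (groupings (b ∷ r)) joinFirst
    ≡⟨ cong (∑[ g ∈ groupings (b ∷ r) ] F ((a ∷ []) ∷ g) +_) (∑-groupings-firstBlock b r joinFirst) ⟩
  ∑-splits (b ∷ r) (λ p s → ∑[ g ∈ groupings s ] F ((a ∷ p) ∷ g)) ∎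
  where
  joinFirst : List (List ℕ) → ℚ
  joinFirst []      = 0ℚ
  joinFirst (B ∷ g) = F ((a ∷ B) ∷ g)
  extend-split : ∀ g → ∑ (extend a g) F ≡ F ((a ∷ []) ∷ g) + joinFirst g
  extend-split []      = refl
  extend-split (B ∷ g) = cong (F ((a ∷ []) ∷ B ∷ g) +_) (+-identityʳ _)

star : (List ℕ → ℚ) → Composition → ℚ
star φ B = ∑[ g ∈ groupings B ] ∏ g φ

star-∷ : ∀ φ a r → star φ (a ∷ r) ≡ ∑-splits r (λ p s → φ (a ∷ p) * star φ s)
star-∷ φ a r = trans (∑-groupings-firstBlock a r (λ g → ∏ g φ))
  (∑-splits-cong r (λ p s _ → sym (*-distribˡ-∑ (φ (a ∷ p)) (groupings s) (λ g → ∏ g φ))))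

star-inverse : ∀ (ε ψ : Composition → ℚ) → ε [] ≡ 1ℚ → (∀ B → (ε ⊛ ψ) B ≡ δ B) →
               ∀ B → star (λ p → - ε p) B ≡ ψ B
star-inverse ε ψ ε[]≡1 ε⊛ψ≡δ B = All.head (tails-induction base step B)
  where
  base : star (λ p → - ε p) [] ≡ ψ []
  base = sym (begin
    ψ []          ≡⟨ sym (*-identityˡ (ψ [])) ⟩
    1ℚ * ψ []     ≡⟨ cong (_* ψ []) (sym ε[]≡1) ⟩
    ε [] * ψ []   ≡⟨ ε⊛ψ≡δ [] ⟩
    1ℚ            ∎)
  step : ∀ a r → All (λ B → star (λ p → - ε p) B ≡ ψ B) (tails r) → star (λ p → - ε p) (a ∷ r) ≡ ψ (a ∷ r)
  step a r IH = begin
    star (λ p → - ε p) (a ∷ r)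
      ≡⟨ star-∷ (λ p → - ε p) a r ⟩
    ∑-splits r (λ p s → - ε (a ∷ p) * star (λ p → - ε p) s)
      ≡⟨ ∑-splits-cong-tails r IH (λ p → cong (- ε (a ∷ p) *_)) ⟩
    ∑-splits r (λ p s → - ε (a ∷ p) * ψ s)
      ≡⟨ ∑-splits-cong r (λ p s _ → sym (neg-distribˡ-* (ε (a ∷ p)) (ψ s))) ⟩
    ∑-splits r (λ p s → - (ε (a ∷ p) * ψ s))
      ≡⟨ sym (neg-distrib-∑-splits r _) ⟩
    - ∑-splits r (λ p s → ε (a ∷ p) * ψ s)
      ≡⟨ sym (inverseˡ-unique (ψ (a ∷ r)) _ ε⊛ψ[a∷r]≡0) ⟩
    ψ (a ∷ r) ∎
    where
    ε⊛ψ[a∷r]≡0 : ψ (a ∷ r) + ∑-splits r (λ p s → ε (a ∷ p) * ψ s) ≡ 0ℚ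
    ε⊛ψ[a∷r]≡0 = trans (cong (_+ ∑-splits r (λ p s → ε (a ∷ p) * ψ s))
                             (sym (trans (cong (_* ψ (a ∷ r)) ε[]≡1) (*-identityˡ (ψ (a ∷ r))))))
                       (ε⊛ψ≡δ (a ∷ r))

-- A grouping together with a cut between two of its blocks is a cut of α together with
-- a grouping of each side.
∑-groupings-∑-cuts : ∀ α (K : List (List ℕ) → List (List ℕ) → ℚ) →
  ∑[ g ∈ groupings α ] ∑-cuts g K ≡ ∑-cuts α (λ p s → ∑[ q ∈ groupings p ] ∑[ t ∈ groupings s ] K q t)
∑-groupings-∑-cuts []      K = refl
∑-groupings-∑-cuts (a ∷ r) K = begin
  ∑[ g ∈ groupings (a ∷ r) ] ∑-cuts g K
    ≡⟨ ∑-groupings-∷ a r (λ g → ∑-cuts g K) ⟩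
  ∑[ g ∈ groupings r ] ∑[ h ∈ extend a g ] ∑-cuts h K
    ≡⟨ ∑-cong (groupings r) extend-cuts ⟩
  ∑[ g ∈ groupings r ] (K [a] g + (∑-cuts g K₁ + ∑-cuts g K₂))
    ≡⟨ trans (∑-distrib-+ (groupings r) _ _) (cong (∑[ g ∈ groupings r ] K [a] g +_) (∑-distrib-+ (groupings r) _ _)) ⟩
  ∑[ g ∈ groupings r ] K [a] g + (∑[ g ∈ groupings r ] ∑-cuts g K₁ + ∑[ g ∈ groupings r ] ∑-cuts g K₂)
    ≡⟨ cong (∑[ g ∈ groupings r ] K [a] g +_)
         (trans (cong₂ _+_ (∑-groupings-∑-cuts r K₁) (∑-groupings-∑-cuts r K₂)) (sym (∑-cuts-distrib-+ r _ _))) ⟩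
  ∑[ t ∈ groupings r ] K [a] t + ∑-cuts r (λ p s → grouped K₁ p s + grouped K₂ p s)
    ≡⟨ cong₂ _+_ (sym (+-identityʳ (∑[ t ∈ groupings r ] K [a] t))) (∑-cuts-cong r (λ p s → sym (grouped-∷ p s))) ⟩
  grouped K (a ∷ []) r + ∑-cuts r (λ p s → grouped K (a ∷ p) s)
    ≡⟨ sym (∑-cuts-∷ a r (grouped K)) ⟩
  ∑-cuts (a ∷ r) (grouped K) ∎
  where
  grouped : (List (List ℕ) → List (List ℕ) → ℚ) → Composition → Composition → ℚ
  grouped L p s = ∑[ q ∈ groupings p ] ∑[ t ∈ groupings s ] L q t
  [a] = (a ∷ []) ∷ []
  K₁ K₂ : List (List ℕ) → List (List ℕ) → ℚ
  K₁ q       t = K ((a ∷ []) ∷ q) t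
  K₂ []      t = 0ℚ
  K₂ (B ∷ q) t = K ((a ∷ B) ∷ q) t
  extend-cuts : ∀ g → ∑[ h ∈ extend a g ] ∑-cuts h K ≡ K [a] g + (∑-cuts g K₁ + ∑-cuts g K₂)
  extend-cuts []      = refl
  extend-cuts (B ∷ g) = trans (cong (∑-cuts ((a ∷ []) ∷ B ∷ g) K +_) (+-identityʳ _))
                              (+-assoc (K [a] (B ∷ g)) _ _)
  grouped-∷ : ∀ p s → grouped K (a ∷ p) s ≡ grouped K₁ p s + grouped K₂ p s
  grouped-∷ p s = begin
    grouped K (a ∷ p) s                                             ≡⟨ ∑-groupings-∷ a p _ ⟩
    ∑[ q ∈ groupings p ] ∑[ h ∈ extend a q ] ∑[ t ∈ groupings s ] K h t ≡⟨ ∑-cong (groupings p) extend-grouped ⟩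
    ∑[ q ∈ groupings p ] (∑[ t ∈ groupings s ] K₁ q t + ∑[ t ∈ groupings s ] K₂ q t)
                                                                    ≡⟨ ∑-distrib-+ (groupings p) _ _ ⟩
    grouped K₁ p s + grouped K₂ p s                                 ∎
    where
    extend-grouped : ∀ q → ∑[ h ∈ extend a q ] ∑[ t ∈ groupings s ] K h t
                           ≡ ∑[ t ∈ groupings s ] K₁ q t + ∑[ t ∈ groupings s ] K₂ q t
    extend-grouped []      = cong (∑[ t ∈ groupings s ] K₁ [] t +_) (sym (∑-zero (groupings s)))
    extend-grouped (B ∷ q) = cong (∑[ t ∈ groupings s ] K₁ (B ∷ q) t +_) (+-identityʳ _)

∏-∑-cuts : ∀ g (φ : List ℕ → ℚ) (K : List (List ℕ) → List (List ℕ) → ℚ) →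
           ∏ g φ * ∑-cuts g K ≡ ∑-cuts g (λ q t → ∏ q φ * ∏ t φ * K q t)
∏-∑-cuts []      φ K = *-zeroʳ 1ℚ
∏-∑-cuts (B ∷ g) φ K = trans (*-distribˡ-∑-splits (∏ (B ∷ g) φ) g _) (∑-splits-cong g split-∏)
  where
  split-∏ : ∀ q t → q ++ t ≡ g → ∏ (B ∷ g) φ * K (B ∷ q) t ≡ ∏ (B ∷ q) φ * ∏ t φ * K (B ∷ q) t
  split-∏ q t refl = cong (_* K (B ∷ q) t) (∏-++ (B ∷ q) t φ)

coarseningSum : (List ℕ → ℚ) → (Composition → ℚ) → Composition → ℚ
coarseningSum φ X α = ∑[ G ∈ groupings α ] ∏ G φ * X (sums G)

coarseningSum-∷ : ∀ φ X a r →
  coarseningSum φ X (a ∷ r) ≡ ∑-cuts (a ∷ r) (λ p s → φ p * coarseningSum φ (λ β → X (sumℕ p ∷ β)) s)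
coarseningSum-∷ φ X a r = trans (∑-groupings-firstBlock a r _) (∑-splits-cong r (λ p s _ →
  trans (∑-cong (groupings s) (λ G → *-assoc (φ (a ∷ p)) (∏ G φ) _)) (sym (*-distribˡ-∑ (φ (a ∷ p)) (groupings s) _))))

coarseningSum-star : ∀ φ X α →
  ∑[ g ∈ groupings α ] ∏ g φ * (∑[ H ∈ groupings (sums g) ] X (sums H)) ≡ coarseningSum (star φ) X α
coarseningSum-star φ X α = All.head (tails-induction base step α) X
  where
  Statement : Composition → Set
  Statement α = ∀ X → ∑[ g ∈ groupings α ] ∏ g φ * (∑[ H ∈ groupings (sums g) ] X (sums H))
                      ≡ coarseningSum (star φ) X α
  base : Statement []
  base X = cong (λ q → 1ℚ * q + 0ℚ) (+-identityʳ (X []))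
  step : ∀ a r → All Statement (tails r) → Statement (a ∷ r)
  step a r IH X = begin
    ∑[ g ∈ groupings (a ∷ r) ] ∏ g φ * (∑[ H ∈ groupings (sums g) ] X (sums H))
      ≡⟨ ∑-cong-groupings (a ∷ r) first-block ⟩
    ∑[ g ∈ groupings (a ∷ r) ] ∑-cuts g (λ q t → ∏ q φ * ∏ t φ * rest (sumℕ (sums q)) t)
      ≡⟨ ∑-groupings-∑-cuts (a ∷ r) _ ⟩
    ∑-cuts (a ∷ r) (λ p s → ∑[ q ∈ groupings p ] ∑[ t ∈ groupings s ] ∏ q φ * ∏ t φ * rest (sumℕ (sums q)) t)
      ≡⟨ ∑-cuts-cong (a ∷ r) factor ⟩
    ∑-cuts (a ∷ r) (λ p s → star φ p * (∑[ t ∈ groupings s ] ∏ t φ * rest (sumℕ p) t))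
      ≡⟨ ∑-splits-cong-tails r IH (λ p IHs → cong (star φ (a ∷ p) *_) (IHs (λ β → X (sumℕ (a ∷ p) ∷ β)))) ⟩
    ∑-cuts (a ∷ r) (λ p s → star φ p * coarseningSum (star φ) (λ β → X (sumℕ p ∷ β)) s)
      ≡⟨ sym (coarseningSum-∷ (star φ) X a r) ⟩
    coarseningSum (star φ) X (a ∷ r) ∎
    where
    rest : ℕ → List (List ℕ) → ℚ
    rest n t = ∑[ H ∈ groupings (sums t) ] X (n ∷ sums H)
    first-block : ∀ g → Grouping (a ∷ r) g → ∏ g φ * (∑[ H ∈ groupings (sums g) ] X (sums H))
                                          ≡ ∑-cuts g (λ q t → ∏ q φ * ∏ t φ * rest (sumℕ (sums q)) t)
    first-block (B ∷ g) _ = trans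
      (cong (∏ (B ∷ g) φ *_) (trans (∑-groupings-firstBlock (sumℕ B) (sums g) _) (∑-splits-map sumℕ g _)))
      (∏-∑-cuts (B ∷ g) φ (λ q t → rest (sumℕ (sums q)) t))
    factor : ∀ p s → ∑[ q ∈ groupings p ] ∑[ t ∈ groupings s ] ∏ q φ * ∏ t φ * rest (sumℕ (sums q)) t
                     ≡ star φ p * (∑[ t ∈ groupings s ] ∏ t φ * rest (sumℕ p) t)
    factor p s = begin
      ∑[ q ∈ groupings p ] ∑[ t ∈ groupings s ] ∏ q φ * ∏ t φ * rest (sumℕ (sums q)) t
        ≡⟨ ∑-cong-groupings p (λ q gr → ∑-cong (groupings s) (λ t →
             trans (cong (λ n → ∏ q φ * ∏ t φ * rest n t) (Grouping-sum gr)) (*-assoc (∏ q φ) (∏ t φ) _))) ⟩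
      ∑[ q ∈ groupings p ] ∑[ t ∈ groupings s ] ∏ q φ * (∏ t φ * rest (sumℕ p) t)
        ≡⟨ ∑-cong (groupings p) (λ q → sym (*-distribˡ-∑ (∏ q φ) (groupings s) _)) ⟩
      ∑[ q ∈ groupings p ] ∏ q φ * (∑[ t ∈ groupings s ] ∏ t φ * rest (sumℕ p) t)
        ≡⟨ sym (*-distribʳ-∑ _ (groupings p) (λ q → ∏ q φ)) ⟩
      star φ p * (∑[ t ∈ groupings s ] ∏ t φ * rest (sumℕ p) t) ∎

joinLast : ℕ → List (List ℕ) → List (List ℕ)
joinLast z []          = []
joinLast z (B ∷ [])    = (B ∷ʳ z) ∷ []
joinLast z (B ∷ C ∷ g) = B ∷ joinLast z (C ∷ g)

extendʳ : ℕ → List (List ℕ) → List (List (List ℕ))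
extendʳ z []      = ((z ∷ []) ∷ []) ∷ []
extendʳ z (B ∷ g) = ((B ∷ g) ∷ʳ (z ∷ [])) ∷ joinLast z (B ∷ g) ∷ []

private
  ∑-transpose-2×2 : ∀ p q r s → ∑[ xs ∈ (p ∷ q ∷ []) ∷ (r ∷ s ∷ []) ∷ [] ] ∑[ x ∈ xs ] x
                                ≡ ∑[ xs ∈ (p ∷ r ∷ []) ∷ (q ∷ s ∷ []) ∷ [] ] ∑[ x ∈ xs ] x
  ∑-transpose-2×2 = solve 4 (λ p q r s → (p :+ (q :+ con 0ℚ)) :+ ((r :+ (s :+ con 0ℚ)) :+ con 0ℚ)
                                    := (p :+ (r :+ con 0ℚ)) :+ ((q :+ (s :+ con 0ℚ)) :+ con 0ℚ)) refl

extendʳ-extend : ∀ a z g (F : List (List ℕ) → ℚ) →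
                 ∑[ h ∈ extendʳ z g ] ∑ (extend a h) F ≡ ∑[ h ∈ extend a g ] ∑ (extendʳ z h) F
extendʳ-extend a z []          F = refl
extendʳ-extend a z (B ∷ [])    F = ∑-transpose-2×2
  (F ((a ∷ []) ∷ B ∷ (z ∷ []) ∷ [])) (F ((a ∷ B) ∷ (z ∷ []) ∷ []))
  (F ((a ∷ []) ∷ (B ∷ʳ z) ∷ [])) (F ((a ∷ (B ∷ʳ z)) ∷ []))
extendʳ-extend a z (B ∷ C ∷ g) F = ∑-transpose-2×2
  (F ((a ∷ []) ∷ B ∷ ((C ∷ g) ∷ʳ (z ∷ [])))) (F ((a ∷ B) ∷ ((C ∷ g) ∷ʳ (z ∷ []))))
  (F ((a ∷ []) ∷ B ∷ joinLast z (C ∷ g))) (F ((a ∷ B) ∷ joinLast z (C ∷ g)))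

∑-groupings-∷ʳ : ∀ w z (F : List (List ℕ) → ℚ) →
                 ∑ (groupings (w ∷ʳ z)) F ≡ ∑[ g ∈ groupings w ] ∑ (extendʳ z g) F
∑-groupings-∷ʳ []      z F = ∑-groupings-∷ z [] F
∑-groupings-∷ʳ (a ∷ w) z F = begin
  ∑ (groupings (a ∷ (w ∷ʳ z))) F                              ≡⟨ ∑-groupings-∷ a (w ∷ʳ z) F ⟩
  ∑[ g ∈ groupings (w ∷ʳ z) ] ∑ (extend a g) F                ≡⟨ ∑-groupings-∷ʳ w z _ ⟩
  ∑[ g ∈ groupings w ] ∑[ h ∈ extendʳ z g ] ∑ (extend a h) F
    ≡⟨ ∑-cong (groupings w) (λ g → extendʳ-extend a z g F) ⟩
  ∑[ g ∈ groupings w ] ∑[ h ∈ extend a g ] ∑ (extendʳ z h) F  ≡⟨ sym (∑-groupings-∷ a w _) ⟩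
  ∑[ g ∈ groupings (a ∷ w) ] ∑ (extendʳ z g) F                ∎

reverseᵍ : List (List ℕ) → List (List ℕ)
reverseᵍ g = reverse (map reverse g)

reverseᵍ-∷ : ∀ B g → reverseᵍ (B ∷ g) ≡ reverseᵍ g ∷ʳ reverse B
reverseᵍ-∷ B g = unfold-reverse (reverse B) (map reverse g)

joinLast-∷ʳ : ∀ z g B → joinLast z (g ∷ʳ B) ≡ g ∷ʳ (B ∷ʳ z)
joinLast-∷ʳ z []          B = refl
joinLast-∷ʳ z (C ∷ [])    B = refl
joinLast-∷ʳ z (C ∷ D ∷ g) B = cong (C ∷_) (joinLast-∷ʳ z (D ∷ g) B)

extendʳ-reverseᵍ : ∀ a g (F : List (List ℕ) → ℚ) →
                   ∑ (extendʳ a (reverseᵍ g)) F ≡ ∑[ h ∈ extend a g ] F (reverseᵍ h)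
extendʳ-reverseᵍ a []      F = refl
extendʳ-reverseᵍ a (B ∷ g) F = begin
  ∑ (extendʳ a (reverseᵍ (B ∷ g))) F
    ≡⟨ cong (λ h → ∑ (extendʳ a h) F) (reverseᵍ-∷ B g) ⟩
  ∑ (extendʳ a (reverseᵍ g ∷ʳ reverse B)) F
    ≡⟨ cong (λ hs → ∑ hs F) (extendʳ-∷ʳ (reverseᵍ g) (reverse B)) ⟩
  F (reverseᵍ g ∷ʳ reverse B ∷ʳ (a ∷ [])) + (F (reverseᵍ g ∷ʳ (reverse B ∷ʳ a)) + 0ℚ)
    ≡⟨ cong₂ (λ h h′ → F h + (F h′ + 0ℚ))
         (trans (cong (_∷ʳ (a ∷ [])) (sym (reverseᵍ-∷ B g))) (sym (reverseᵍ-∷ (a ∷ []) (B ∷ g))))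
         (trans (cong (reverseᵍ g ∷ʳ_) (sym (unfold-reverse a B))) (sym (reverseᵍ-∷ (a ∷ B) g))) ⟩
  F (reverseᵍ ((a ∷ []) ∷ B ∷ g)) + (F (reverseᵍ ((a ∷ B) ∷ g)) + 0ℚ) ∎
  where
  extendʳ-∷ʳ : ∀ h C → extendʳ a (h ∷ʳ C) ≡ (h ∷ʳ C ∷ʳ (a ∷ [])) ∷ (h ∷ʳ (C ∷ʳ a)) ∷ []
  extendʳ-∷ʳ []      C = refl
  extendʳ-∷ʳ (D ∷ h) C = cong (λ J → ((D ∷ h) ∷ʳ C ∷ʳ (a ∷ [])) ∷ J ∷ []) (joinLast-∷ʳ a (D ∷ h) C)

∑-groupings-reverse : ∀ w (F : List (List ℕ) → ℚ) → ∑ (groupings (reverse w)) F ≡ ∑[ g ∈ groupings w ] F (reverseᵍ g)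
∑-groupings-reverse []      F = refl
∑-groupings-reverse (a ∷ w) F = begin
  ∑ (groupings (reverse (a ∷ w))) F
    ≡⟨ cong (λ v → ∑ (groupings v) F) (unfold-reverse a w) ⟩
  ∑ (groupings (reverse w ∷ʳ a)) F                               ≡⟨ ∑-groupings-∷ʳ (reverse w) a F ⟩
  ∑[ h ∈ groupings (reverse w) ] ∑ (extendʳ a h) F               ≡⟨ ∑-groupings-reverse w _ ⟩
  ∑[ g ∈ groupings w ] ∑ (extendʳ a (reverseᵍ g)) F
    ≡⟨ ∑-cong (groupings w) (λ g → extendʳ-reverseᵍ a g F) ⟩
  ∑[ g ∈ groupings w ] ∑[ h ∈ extend a g ] F (reverseᵍ h)        ≡⟨ sym (∑-groupings-∷ a w _) ⟩
  ∑[ g ∈ groupings (a ∷ w) ] F (reverseᵍ g)                      ∎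

sums-reverseᵍ : ∀ g → sums (reverseᵍ g) ≡ reverse (sums g)
sums-reverseᵍ g = begin
  map sumℕ (reverse (map reverse g))   ≡⟨ reverse-map sumℕ (map reverse g) ⟩
  reverse (map sumℕ (map reverse g))   ≡⟨ cong reverse (sym (map-∘ g)) ⟩
  reverse (map (sumℕ ∘ reverse) g)     ≡⟨ cong reverse (map-cong sumℕ-reverse g) ⟩
  reverse (sums g)                     ∎

-- Quasi-shuffles and reversal

quasiShuffle-[]ʳ : ∀ u → quasiShuffle u [] ≡ u ∷ []
quasiShuffle-[]ʳ []      = refl
quasiShuffle-[]ʳ (a ∷ u) = refl

∑-quasiShuffle-[]ʳ : ∀ u (Y : Composition → ℚ) → ∑ (quasiShuffle u []) Y ≡ Y u + 0ℚ
∑-quasiShuffle-[]ʳ u Y = cong (λ ws → ∑ ws Y) (quasiShuffle-[]ʳ u)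

∑-quasiShuffle-∷-∷ : ∀ a u b v (Y : Composition → ℚ) →
  ∑ (quasiShuffle (a ∷ u) (b ∷ v)) Y
  ≡ ∑[ w ∈ quasiShuffle u (b ∷ v) ] Y (a ∷ w) + (∑[ w ∈ quasiShuffle (a ∷ u) v ] Y (b ∷ w)
                                                 + ∑[ w ∈ quasiShuffle u v ] Y ((a ℕ.+ b) ∷ w))
∑-quasiShuffle-∷-∷ a u b v Y = trans (∑-++ (map (a ∷_) (quasiShuffle u (b ∷ v))) _ Y)
  (cong₂ _+_ (∑-map (a ∷_) (quasiShuffle u (b ∷ v)) Y)
    (trans (∑-++ (map (b ∷_) (quasiShuffle (a ∷ u) v)) _ Y)
      (cong₂ _+_ (∑-map (b ∷_) (quasiShuffle (a ∷ u) v) Y) (∑-map ((a ℕ.+ b) ∷_) (quasiShuffle u v) Y))))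

∑-quasiShuffle-∷ʳ : ∀ u v x y (Y : Composition → ℚ) →
  ∑ (quasiShuffle (u ∷ʳ x) (v ∷ʳ y)) Y
  ≡ ∑[ w ∈ quasiShuffle u (v ∷ʳ y) ] Y (w ∷ʳ x) + ∑[ w ∈ quasiShuffle (u ∷ʳ x) v ] Y (w ∷ʳ y)
    + ∑[ w ∈ quasiShuffle u v ] Y (w ∷ʳ (x ℕ.+ y))
∑-quasiShuffle-∷ʳ [] [] x y Y =
  solve 3 (λ p q r → p :+ (q :+ (r :+ con 0ℚ)) := (q :+ con 0ℚ) :+ (p :+ con 0ℚ) :+ (r :+ con 0ℚ)) refl
    (Y (x ∷ y ∷ [])) (Y (y ∷ x ∷ [])) (Y ((x ℕ.+ y) ∷ []))
∑-quasiShuffle-∷ʳ [] (b ∷ v) x y Y = begin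
  ∑ (quasiShuffle (x ∷ []) (b ∷ (v ∷ʳ y))) Y
    ≡⟨ ∑-quasiShuffle-∷-∷ x [] b (v ∷ʳ y) Y ⟩
  (p + 0ℚ) + (∑[ w ∈ quasiShuffle (x ∷ []) (v ∷ʳ y) ] Y (b ∷ w) + (q + 0ℚ))
    ≡⟨ cong (λ z → (p + 0ℚ) + (z + (q + 0ℚ))) (∑-quasiShuffle-∷ʳ [] v x y (λ w → Y (b ∷ w))) ⟩
  (p + 0ℚ) + (((r + 0ℚ) + S + (t + 0ℚ)) + (q + 0ℚ))
    ≡⟨ solve 5 (λ p q r t S → (p :+ con 0ℚ) :+ (((r :+ con 0ℚ) :+ S :+ (t :+ con 0ℚ)) :+ (q :+ con 0ℚ))
                              := (r :+ con 0ℚ) :+ ((p :+ con 0ℚ) :+ (S :+ (q :+ con 0ℚ))) :+ (t :+ con 0ℚ)) refl p q r t S ⟩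
  (r + 0ℚ) + ((p + 0ℚ) + (S + (q + 0ℚ))) + (t + 0ℚ)
    ≡⟨ cong (λ z → (r + 0ℚ) + z + (t + 0ℚ)) (sym (∑-quasiShuffle-∷-∷ x [] b v (λ w → Y (w ∷ʳ y)))) ⟩
  ∑[ w ∈ quasiShuffle [] ((b ∷ v) ∷ʳ y) ] Y (w ∷ʳ x) + ∑[ w ∈ quasiShuffle (x ∷ []) (b ∷ v) ] Y (w ∷ʳ y)
    + ∑[ w ∈ quasiShuffle [] (b ∷ v) ] Y (w ∷ʳ (x ℕ.+ y)) ∎
  where
  p = Y (x ∷ b ∷ (v ∷ʳ y))
  q = Y ((x ℕ.+ b) ∷ (v ∷ʳ y))
  r = Y (b ∷ ((v ∷ʳ y) ∷ʳ x))
  t = Y (b ∷ (v ∷ʳ (x ℕ.+ y)))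
  S = ∑[ w ∈ quasiShuffle (x ∷ []) v ] Y (b ∷ (w ∷ʳ y))
∑-quasiShuffle-∷ʳ (a ∷ u) [] x y Y = begin
  ∑ (quasiShuffle (a ∷ (u ∷ʳ x)) (y ∷ [])) Y
    ≡⟨ ∑-quasiShuffle-∷-∷ a (u ∷ʳ x) y [] Y ⟩
  ∑[ w ∈ quasiShuffle (u ∷ʳ x) (y ∷ []) ] Y (a ∷ w)
    + ((p + 0ℚ) + ∑[ w ∈ quasiShuffle (u ∷ʳ x) [] ] Y ((a ℕ.+ y) ∷ w))
    ≡⟨ cong₂ (λ z z′ → z + ((p + 0ℚ) + z′)) (∑-quasiShuffle-∷ʳ u [] x y (λ w → Y (a ∷ w)))
                                             (∑-quasiShuffle-[]ʳ (u ∷ʳ x) (λ w → Y ((a ℕ.+ y) ∷ w))) ⟩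
  (S + ∑[ w ∈ quasiShuffle (u ∷ʳ x) [] ] Y (a ∷ (w ∷ʳ y)) + ∑[ w ∈ quasiShuffle u [] ] Y (a ∷ (w ∷ʳ (x ℕ.+ y))))
    + ((p + 0ℚ) + (q + 0ℚ))
    ≡⟨ cong₂ (λ z z′ → (S + z + z′) + ((p + 0ℚ) + (q + 0ℚ)))
             (∑-quasiShuffle-[]ʳ (u ∷ʳ x) _) (∑-quasiShuffle-[]ʳ u _) ⟩
  (S + (r + 0ℚ) + (t + 0ℚ)) + ((p + 0ℚ) + (q + 0ℚ))
    ≡⟨ solve 5 (λ p q r t S → (S :+ (r :+ con 0ℚ) :+ (t :+ con 0ℚ)) :+ ((p :+ con 0ℚ) :+ (q :+ con 0ℚ))
                              := (S :+ ((p :+ con 0ℚ) :+ (q :+ con 0ℚ))) :+ (r :+ con 0ℚ) :+ (t :+ con 0ℚ)) refl p q r t S ⟩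
  (S + ((p + 0ℚ) + (q + 0ℚ))) + (r + 0ℚ) + (t + 0ℚ)
    ≡⟨ cong₂ (λ z z′ → z + (r + 0ℚ) + z′)
         (sym (trans (∑-quasiShuffle-∷-∷ a u y [] (λ w → Y (w ∷ʳ x)))
                     (cong (λ z → S + ((p + 0ℚ) + z)) (∑-quasiShuffle-[]ʳ u _))))
         (sym (∑-quasiShuffle-[]ʳ (a ∷ u) (λ w → Y (w ∷ʳ (x ℕ.+ y))))) ⟩
  ∑[ w ∈ quasiShuffle (a ∷ u) (y ∷ []) ] Y (w ∷ʳ x) + ∑[ w ∈ quasiShuffle ((a ∷ u) ∷ʳ x) [] ] Y (w ∷ʳ y)
    + ∑[ w ∈ quasiShuffle (a ∷ u) [] ] Y (w ∷ʳ (x ℕ.+ y)) ∎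
  where
  p = Y (y ∷ a ∷ (u ∷ʳ x))
  q = Y ((a ℕ.+ y) ∷ (u ∷ʳ x))
  r = Y (a ∷ ((u ∷ʳ x) ∷ʳ y))
  t = Y (a ∷ (u ∷ʳ (x ℕ.+ y)))
  S = ∑[ w ∈ quasiShuffle u (y ∷ []) ] Y (a ∷ (w ∷ʳ x))
∑-quasiShuffle-∷ʳ (a ∷ u) (b ∷ v) x y Y = begin
  ∑ (quasiShuffle (a ∷ (u ∷ʳ x)) (b ∷ (v ∷ʳ y))) Y
    ≡⟨ ∑-quasiShuffle-∷-∷ a (u ∷ʳ x) b (v ∷ʳ y) Y ⟩
  ∑[ w ∈ quasiShuffle (u ∷ʳ x) (b ∷ (v ∷ʳ y)) ] Y (a ∷ w)
    + (∑[ w ∈ quasiShuffle (a ∷ (u ∷ʳ x)) (v ∷ʳ y) ] Y (b ∷ w)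
    + ∑[ w ∈ quasiShuffle (u ∷ʳ x) (v ∷ʳ y) ] Y ((a ℕ.+ b) ∷ w))
    ≡⟨ cong₂ _+_ (∑-quasiShuffle-∷ʳ u (b ∷ v) x y (λ w → Y (a ∷ w)))
         (cong₂ _+_ (∑-quasiShuffle-∷ʳ (a ∷ u) v x y (λ w → Y (b ∷ w)))
                    (∑-quasiShuffle-∷ʳ u v x y (λ w → Y ((a ℕ.+ b) ∷ w)))) ⟩
  (P₁ + P₂ + P₃) + ((Q₁ + Q₂ + Q₃) + (R₁ + R₂ + R₃))
    ≡⟨ solve 9 (λ P₁ P₂ P₃ Q₁ Q₂ Q₃ R₁ R₂ R₃ →
                 (P₁ :+ P₂ :+ P₃) :+ ((Q₁ :+ Q₂ :+ Q₃) :+ (R₁ :+ R₂ :+ R₃))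
                 := (P₁ :+ (Q₁ :+ R₁)) :+ (P₂ :+ (Q₂ :+ R₂)) :+ (P₃ :+ (Q₃ :+ R₃))) refl
               P₁ P₂ P₃ Q₁ Q₂ Q₃ R₁ R₂ R₃ ⟩
  (P₁ + (Q₁ + R₁)) + (P₂ + (Q₂ + R₂)) + (P₃ + (Q₃ + R₃))
    ≡⟨ sym (cong₂ _+_ (cong₂ _+_ (∑-quasiShuffle-∷-∷ a u b (v ∷ʳ y) (λ w → Y (w ∷ʳ x)))
                                  (∑-quasiShuffle-∷-∷ a (u ∷ʳ x) b v (λ w → Y (w ∷ʳ y))))
                       (∑-quasiShuffle-∷-∷ a u b v (λ w → Y (w ∷ʳ (x ℕ.+ y))))) ⟩
  ∑[ w ∈ quasiShuffle (a ∷ u) ((b ∷ v) ∷ʳ y) ] Y (w ∷ʳ x)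
    + ∑[ w ∈ quasiShuffle ((a ∷ u) ∷ʳ x) (b ∷ v) ] Y (w ∷ʳ y)
    + ∑[ w ∈ quasiShuffle (a ∷ u) (b ∷ v) ] Y (w ∷ʳ (x ℕ.+ y)) ∎
  where
  P₁ = ∑[ w ∈ quasiShuffle u ((b ∷ v) ∷ʳ y) ] Y (a ∷ (w ∷ʳ x))
  P₂ = ∑[ w ∈ quasiShuffle (u ∷ʳ x) (b ∷ v) ] Y (a ∷ (w ∷ʳ y))
  P₃ = ∑[ w ∈ quasiShuffle u (b ∷ v) ] Y (a ∷ (w ∷ʳ (x ℕ.+ y)))
  Q₁ = ∑[ w ∈ quasiShuffle (a ∷ u) (v ∷ʳ y) ] Y (b ∷ (w ∷ʳ x))
  Q₂ = ∑[ w ∈ quasiShuffle ((a ∷ u) ∷ʳ x) v ] Y (b ∷ (w ∷ʳ y))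
  Q₃ = ∑[ w ∈ quasiShuffle (a ∷ u) v ] Y (b ∷ (w ∷ʳ (x ℕ.+ y)))
  R₁ = ∑[ w ∈ quasiShuffle u (v ∷ʳ y) ] Y ((a ℕ.+ b) ∷ (w ∷ʳ x))
  R₂ = ∑[ w ∈ quasiShuffle (u ∷ʳ x) v ] Y ((a ℕ.+ b) ∷ (w ∷ʳ y))
  R₃ = ∑[ w ∈ quasiShuffle u v ] Y ((a ℕ.+ b) ∷ (w ∷ʳ (x ℕ.+ y)))

∑-quasiShuffle-reverse : ∀ u v (Y : Composition → ℚ) →
  ∑ (quasiShuffle u v) Y ≡ ∑[ w ∈ quasiShuffle (reverse u) (reverse v) ] Y (reverse w)
∑-quasiShuffle-reverse []      v       Y = cong (λ w → Y w + 0ℚ) (sym (reverse-involutive v))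
∑-quasiShuffle-reverse (a ∷ u) []      Y = trans (cong (λ w → Y w + 0ℚ) (sym (reverse-involutive (a ∷ u))))
  (sym (∑-quasiShuffle-[]ʳ (reverse (a ∷ u)) (Y ∘ reverse)))
∑-quasiShuffle-reverse (a ∷ u) (b ∷ v) Y = begin
  ∑ (quasiShuffle (a ∷ u) (b ∷ v)) Y
    ≡⟨ ∑-quasiShuffle-∷-∷ a u b v Y ⟩
  ∑[ w ∈ quasiShuffle u (b ∷ v) ] Y (a ∷ w) + (∑[ w ∈ quasiShuffle (a ∷ u) v ] Y (b ∷ w)
    + ∑[ w ∈ quasiShuffle u v ] Y ((a ℕ.+ b) ∷ w))
    ≡⟨ cong₂ _+_ (∑-quasiShuffle-reverse u (b ∷ v) _)
         (cong₂ _+_ (∑-quasiShuffle-reverse (a ∷ u) v _) (∑-quasiShuffle-reverse u v _)) ⟩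
  ∑[ w ∈ quasiShuffle u′ (reverse (b ∷ v)) ] Y (a ∷ reverse w)
    + (∑[ w ∈ quasiShuffle (reverse (a ∷ u)) v′ ] Y (b ∷ reverse w)
    + ∑[ w ∈ quasiShuffle u′ v′ ] Y ((a ℕ.+ b) ∷ reverse w))
    ≡⟨ cong₂ (λ vb ua → ∑[ w ∈ quasiShuffle u′ vb ] Y (a ∷ reverse w)
                        + (∑[ w ∈ quasiShuffle ua v′ ] Y (b ∷ reverse w)
                           + ∑[ w ∈ quasiShuffle u′ v′ ] Y ((a ℕ.+ b) ∷ reverse w)))
         (unfold-reverse b v) (unfold-reverse a u) ⟩
  ∑[ w ∈ quasiShuffle u′ (v′ ∷ʳ b) ] Y (a ∷ reverse w)
    + (∑[ w ∈ quasiShuffle (u′ ∷ʳ a) v′ ] Y (b ∷ reverse w)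
    + ∑[ w ∈ quasiShuffle u′ v′ ] Y ((a ℕ.+ b) ∷ reverse w))
    ≡⟨ cong₂ _+_ (∑-cong (quasiShuffle u′ (v′ ∷ʳ b)) (λ w → cong Y (sym (reverse-∷ʳ w a))))
         (cong₂ _+_ (∑-cong (quasiShuffle (u′ ∷ʳ a) v′) (λ w → cong Y (sym (reverse-∷ʳ w b))))
                    (∑-cong (quasiShuffle u′ v′) (λ w → cong Y (sym (reverse-∷ʳ w (a ℕ.+ b)))))) ⟩
  ∑[ w ∈ quasiShuffle u′ (v′ ∷ʳ b) ] Y (reverse (w ∷ʳ a))
    + (∑[ w ∈ quasiShuffle (u′ ∷ʳ a) v′ ] Y (reverse (w ∷ʳ b))
    + ∑[ w ∈ quasiShuffle u′ v′ ] Y (reverse (w ∷ʳ (a ℕ.+ b))))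
    ≡⟨ trans (sym (+-assoc (∑[ w ∈ quasiShuffle u′ (v′ ∷ʳ b) ] Y (reverse (w ∷ʳ a))) _ _))
             (sym (∑-quasiShuffle-∷ʳ u′ v′ a b (Y ∘ reverse))) ⟩
  ∑[ w ∈ quasiShuffle (u′ ∷ʳ a) (v′ ∷ʳ b) ] Y (reverse w)
    ≡⟨ cong₂ (λ ua vb → ∑[ w ∈ quasiShuffle ua vb ] Y (reverse w)) (sym (unfold-reverse a u)) (sym (unfold-reverse b v)) ⟩
  ∑[ w ∈ quasiShuffle (reverse (a ∷ u)) (reverse (b ∷ v)) ] Y (reverse w) ∎
  where
  u′ = reverse u
  v′ = reverse v
  reverse-∷ʳ : ∀ (w : Composition) x → reverse (w ∷ʳ x) ≡ x ∷ reverse w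
  reverse-∷ʳ w x = reverse-++ w (x ∷ [])

-- The antipode of a monomial

⟪_,_⟫ : QSymElt → (Composition → ℚ) → ℚ
⟪ f , X ⟫ = ∑[ t ∈ f ] proj₁ t * X (proj₂ t)

indicator : Composition → Composition → ℚ
indicator γ β = 𝟙 ⌊ ≡-dec ℕ._≟_ β γ ⌋

coeff-⟪⟫ : ∀ f γ → coeff f γ ≡ ⟪ f , indicator γ ⟫
coeff-⟪⟫ []            γ = refl
coeff-⟪⟫ ((c , β) ∷ f) γ with ≡-dec ℕ._≟_ β γ
... | yes _ = cong₂ _+_ (sym (*-identityʳ c)) (coeff-⟪⟫ f γ)
... | no  _ = trans (coeff-⟪⟫ f γ) (sym (trans (cong (_+ ⟪ f , indicator γ ⟫) (*-zeroʳ c)) (+-identityˡ _)))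

⟪scale⟫ : ∀ c f X → ⟪ scale c f , X ⟫ ≡ c * ⟪ f , X ⟫
⟪scale⟫ c f X = trans (∑-map _ f _)
  (trans (∑-cong f (λ t → *-assoc c (proj₁ t) (X (proj₂ t)))) (sym (*-distribˡ-∑ c f _)))

⟪M·⟫ : ∀ u g X → ⟪ M u · g , X ⟫ ≡ ⟪ g , (λ v → ∑ (quasiShuffle u v) X) ⟫
⟪M·⟫ u g X = begin
  ⟪ M u · g , X ⟫                                       ≡⟨ trans (∑-++ (concatMap terms g) [] _) (+-identityʳ _) ⟩
  ∑[ t ∈ concatMap terms g ] proj₁ t * X (proj₂ t)       ≡⟨ ∑-concatMap terms g _ ⟩
  ∑[ t ∈ g ] ⟪ terms t , X ⟫                             ≡⟨ ∑-cong g shuffles ⟩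
  ⟪ g , (λ v → ∑ (quasiShuffle u v) X) ⟫                 ∎
  where
  terms : ℚ × Composition → QSymElt
  terms t = map (λ w → (1ℚ * proj₁ t , w)) (quasiShuffle u (proj₂ t))
  shuffles : ∀ t → ⟪ terms t , X ⟫ ≡ proj₁ t * ∑ (quasiShuffle u (proj₂ t)) X
  shuffles (c , v) = trans (∑-map _ (quasiShuffle u v) _) (trans
    (∑-cong (quasiShuffle u v) (λ w → cong (_* X w) (*-identityˡ c))) (sym (*-distribˡ-∑ c (quasiShuffle u v) X)))

⟪antipode⟫ : ∀ f X → ⟪ antipode f , X ⟫ ≡ ⟪ f , (λ β → ⟪ antipodeM β , X ⟫) ⟫
⟪antipode⟫ f X = trans (∑-concatMap _ f _) (∑-cong f (λ t → ⟪scale⟫ (proj₁ t) (antipodeM (proj₂ t)) X))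

⟪shuffleFn⟫-groupings : ∀ α X →
  ⟪ shuffleFn α , X ⟫ ≡ ∑[ g ∈ groupings α ] 𝟙 (mo α ≤c? sums g) * (cCoeff g * X (sums g))
⟪shuffleFn⟫-groupings α X = trans (∑-concatMap _ (groupings α) _)
  (∑-cong (groupings α) (λ g → selected (mo α ≤c? sums g) (cCoeff g) (sums g)))
  where
  selected : ∀ b c β → ⟪ (if b then (c , β) ∷ [] else []) , X ⟫ ≡ 𝟙 b * (c * X β)
  selected true  c β = trans (+-identityʳ (c * X β)) (sym (*-identityˡ (c * X β)))
  selected false c β = sym (*-zeroˡ (c * X β))

antipodeSuffixes-tails : ∀ r → antipodeSuffixes r ≡ map antipodeM (tails r)
antipodeSuffixes-tails []      = refl
antipodeSuffixes-tails (a ∷ r) = cong (antipodeM (a ∷ r) ∷_) (antipodeSuffixes-tails r)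

zipWithL-map₁ : ∀ {A B C : Set} (F : A → B → C) (h : A → A) xs ys →
                zipWithL F (map h xs) ys ≡ zipWithL (F ∘ h) xs ys
zipWithL-map₁ F h []       ys       = refl
zipWithL-map₁ F h (x ∷ xs) []       = refl
zipWithL-map₁ F h (x ∷ xs) (y ∷ ys) = cong (F (h x) y ∷_) (zipWithL-map₁ F h xs ys)

∑-zipWithL-inits-tails : ∀ {B C : Set} r (F : List ℕ → B → C) (H : List ℕ → B) (S : C → ℚ) →
                         ∑ (zipWithL F (inits r) (map H (tails r))) S ≡ ∑-splits r (λ p t → S (F p (H t)))
∑-zipWithL-inits-tails []      F H S = +-identityʳ _
∑-zipWithL-inits-tails (x ∷ r) F H S = cong (S (F [] (H (x ∷ r))) +_) (trans
  (cong (λ zs → ∑ zs S) (zipWithL-map₁ F (x ∷_) (inits r) (map H (tails r))))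
  (∑-zipWithL-inits-tails r (F ∘ (x ∷_)) H S))

∑-quasiShuffleʳ : (Composition → ℚ) → Composition → Composition → ℚ
∑-quasiShuffleʳ Y u []      = 0ℚ
∑-quasiShuffleʳ Y u (b ∷ v) = ∑[ w ∈ quasiShuffle u v ] Y (b ∷ w)

coarseShuffles coarseShufflesʳ : (Composition → ℚ) → Composition → Composition → ℚ
coarseShuffles  Y u D = ∑[ G ∈ groupings D ] ∑ (quasiShuffle u (sums G)) Y
coarseShufflesʳ Y u D = ∑[ G ∈ groupings D ] ∑-quasiShuffleʳ Y u (sums G)

-- Split by the first letter: a quasi-shuffle of x ∷ u with a coarsening of D starts with x or
-- with x added to the first block sum (the terms of coarseShufflesʳ Y u (x ∷ D), where x is a
-- block of its own or joins the first block), or with the first block sum.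
coarseShuffles-∷ : ∀ Y x u D →
                   coarseShuffles Y (x ∷ u) D ≡ coarseShufflesʳ Y u (x ∷ D) + coarseShufflesʳ Y (x ∷ u) D
coarseShuffles-∷ Y x u D = sym (begin
  coarseShufflesʳ Y u (x ∷ D) + coarseShufflesʳ Y (x ∷ u) D
    ≡⟨ cong (_+ coarseShufflesʳ Y (x ∷ u) D) (∑-groupings-∷ x D _) ⟩
  ∑[ g ∈ groupings D ] ∑[ G ∈ extend x g ] ∑-quasiShuffleʳ Y u (sums G) + coarseShufflesʳ Y (x ∷ u) D
    ≡⟨ sym (∑-distrib-+ (groupings D) _ _) ⟩
  ∑[ g ∈ groupings D ] (∑[ G ∈ extend x g ] ∑-quasiShuffleʳ Y u (sums G) + ∑-quasiShuffleʳ Y (x ∷ u) (sums g))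
    ≡⟨ ∑-cong (groupings D) by-first-letter ⟩
  coarseShuffles Y (x ∷ u) D ∎)
  where
  by-first-letter : ∀ g → ∑[ G ∈ extend x g ] ∑-quasiShuffleʳ Y u (sums G) + ∑-quasiShuffleʳ Y (x ∷ u) (sums g)
                          ≡ ∑ (quasiShuffle (x ∷ u) (sums g)) Y
  by-first-letter [] rewrite ℕ.+-identityʳ x = trans (cong (λ z → z + 0ℚ + 0ℚ) (∑-quasiShuffle-[]ʳ u (λ w → Y (x ∷ w))))
    (solve 1 (λ y → y :+ con 0ℚ :+ con 0ℚ :+ con 0ℚ := y :+ con 0ℚ) refl (Y (x ∷ u)))
  by-first-letter (B ∷ g) rewrite ℕ.+-identityʳ x = trans
    (solve 3 (λ p q r → (p :+ (r :+ con 0ℚ)) :+ q := p :+ (q :+ r)) refl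
      (∑[ w ∈ quasiShuffle u (sumℕ B ∷ sums g) ] Y (x ∷ w)) (∑[ w ∈ quasiShuffle (x ∷ u) (sums g) ] Y (sumℕ B ∷ w))
      (∑[ w ∈ quasiShuffle u (sums g) ] Y ((x ℕ.+ sumℕ B) ∷ w)))
    (sym (∑-quasiShuffle-∷-∷ x u (sumℕ B) (sums g) Y))

-- By coarseShuffles-∷ the alternating sum telescopes.
coarseShuffles-telescope : ∀ Y x u D →
  ∑-splits D (λ p t → signℚ (length t) * coarseShuffles Y (reverse p ++ x ∷ u) t)
  ≡ signℚ (length D) * coarseShufflesʳ Y u (x ∷ D)
coarseShuffles-telescope Y x u []      =
  cong (1ℚ *_) (trans (coarseShuffles-∷ Y x u []) (+-identityʳ (coarseShufflesʳ Y u (x ∷ []))))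
coarseShuffles-telescope Y x u (y ∷ D) = begin
  s′ * coarseShuffles Y (x ∷ u) (y ∷ D)
    + ∑-splits D (λ p t → signℚ (length t) * coarseShuffles Y (reverse (y ∷ p) ++ x ∷ u) t)
    ≡⟨ cong₂ _+_ (cong (s′ *_) (coarseShuffles-∷ Y x u (y ∷ D)))
                 (trans (∑-splits-cong D (λ p t _ → cong (λ v → signℚ (length t) * coarseShuffles Y v t) (reverse-∷-++ y p)))
                        (coarseShuffles-telescope Y y (x ∷ u) D)) ⟩
  s′ * (coarseShufflesʳ Y u (x ∷ y ∷ D) + coarseShufflesʳ Y (x ∷ u) (y ∷ D)) + s * coarseShufflesʳ Y (x ∷ u) (y ∷ D)
    ≡⟨ solve 3 (λ s p q → (:- s) :* (p :+ q) :+ s :* q := (:- s) :* p) refl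
         s (coarseShufflesʳ Y u (x ∷ y ∷ D)) (coarseShufflesʳ Y (x ∷ u) (y ∷ D)) ⟩
  s′ * coarseShufflesʳ Y u (x ∷ y ∷ D) ∎
  where
  s = signℚ (length D)
  s′ = signℚ (length (y ∷ D))
  reverse-∷-++ : ∀ (y : ℕ) p → reverse (y ∷ p) ++ x ∷ u ≡ reverse p ++ y ∷ x ∷ u
  reverse-∷-++ y p = trans (cong (_++ x ∷ u) (unfold-reverse y p)) (++-assoc (reverse p) (y ∷ []) (x ∷ u))

-- Reversing the quasi-shuffles turns the defining recursion of the antipode into a telescoping sum.
⟪antipodeM⟫ : ∀ α X → ⟪ antipodeM α , X ⟫ ≡ signℚ (length α) * (∑[ G ∈ groupings α ] X (reverse (sums G)))
⟪antipodeM⟫ α X = All.head (tails-induction base step α) X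
  where
  Statement : Composition → Set
  Statement α = ∀ X → ⟪ antipodeM α , X ⟫ ≡ signℚ (length α) * (∑[ G ∈ groupings α ] X (reverse (sums G)))
  base : Statement []
  base X = solve 1 (λ y → con 1ℚ :* y :+ con 0ℚ := con 1ℚ :* (y :+ con 0ℚ)) refl (X [])
  step : ∀ a r → All Statement (tails r) → Statement (a ∷ r)
  step a r IH X = begin
    ⟪ antipodeM (a ∷ r) , X ⟫
      ≡⟨ ⟪scale⟫ (- 1ℚ) (concatMap (λ f → f) (zipWithL term (inits r) (antipodeSuffixes r))) X ⟩
    - 1ℚ * ⟪ concatMap (λ f → f) (zipWithL term (inits r) (antipodeSuffixes r)) , X ⟫
      ≡⟨ cong (λ fs → - 1ℚ * ⟪ concatMap (λ f → f) (zipWithL term (inits r) fs) , X ⟫) (antipodeSuffixes-tails r) ⟩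
    - 1ℚ * ⟪ concatMap (λ f → f) (zipWithL term (inits r) (map antipodeM (tails r))) , X ⟫
      ≡⟨ cong (- 1ℚ *_) (trans (∑-concatMap _ (zipWithL term (inits r) (map antipodeM (tails r))) _)
                               (∑-zipWithL-inits-tails r term antipodeM (⟪_, X ⟫))) ⟩
    - 1ℚ * ∑-splits r (λ p t → ⟪ M (a ∷ p) · antipodeM t , X ⟫)
      ≡⟨ cong (- 1ℚ *_) (∑-splits-cong-tails r IH (λ p {t} IHt → trans (⟪M·⟫ (a ∷ p) (antipodeM t) X) (IHt _))) ⟩
    - 1ℚ * ∑-splits r (λ p t → signℚ (length t) * (∑[ G ∈ groupings t ] ∑ (quasiShuffle (a ∷ p) (reverse (sums G))) X))
      ≡⟨ cong (- 1ℚ *_) (∑-splits-cong r (λ p t _ → cong (signℚ (length t) *_) (∑-cong (groupings t) (λ G →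
           trans (∑-quasiShuffle-reverse (a ∷ p) (reverse (sums G)) X)
                 (cong₂ (λ v w → ∑ (quasiShuffle v w) Y) (unfold-reverse a p) (reverse-involutive (sums G))))))) ⟩
    - 1ℚ * ∑-splits r (λ p t → signℚ (length t) * coarseShuffles Y (reverse p ++ a ∷ []) t)
      ≡⟨ cong (- 1ℚ *_) (coarseShuffles-telescope Y a [] r) ⟩
    - 1ℚ * (signℚ (length r) * coarseShufflesʳ Y [] (a ∷ r))
      ≡⟨ cong (λ z → - 1ℚ * (signℚ (length r) * z)) (∑-cong-groupings (a ∷ r) (λ { (B ∷ G) _ → +-identityʳ _ })) ⟩
    - 1ℚ * (signℚ (length r) * (∑[ G ∈ groupings (a ∷ r) ] Y (sums G)))
      ≡⟨ solve 2 (λ s z → con (- 1ℚ) :* (s :* z) := (:- s) :* z) refl (signℚ (length r)) _ ⟩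
    signℚ (length (a ∷ r)) * (∑[ G ∈ groupings (a ∷ r) ] X (reverse (sums G))) ∎
    where
    Y : Composition → ℚ
    Y = X ∘ reverse
    term : List ℕ → QSymElt → QSymElt
    term p f = M (a ∷ p) · f

-- The block weights of the shuffle function

isOdd≡not-isEven : ∀ n → isOdd n ≡ not (isEven n)
isOdd≡not-isEven n with n ℕ.% 2 | ℕ.m%n<n n 2
... | 0           | _                       = refl
... | 1           | _                       = refl
... | suc (suc _) | ℕ.s≤s (ℕ.s≤s ())

length-filter-≟ : ∀ {A : Set} (P : A → Bool) xs → length (filter (λ x → P x Bool.≟ true) xs) ≡ count P xs
length-filter-≟ P []       = refl
length-filter-≟ P (x ∷ xs) with P x
... | true  = cong suc (length-filter-≟ P xs)
... | false = length-filter-≟ P xs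

count-cong : ∀ {A : Set} {P Q : A → Bool} → (∀ x → P x ≡ Q x) → ∀ xs → count P xs ≡ count Q xs
count-cong P≗Q []       = refl
count-cong P≗Q (x ∷ xs) = cong₂ (λ b n → if b then suc n else n) (P≗Q x) (count-cong P≗Q xs)

blockCoeff-e⁺ : ∀ B → blockCoeff B ≡ e⁺ (count (not ∘ isEven) B) * e⁺ (count isEven B)
blockCoeff-e⁺ B = begin
  blockCoeff B
    ≡⟨ sym (/-*-/ (ℤ.+ 1) (ℤ.+ 1) (countOdd B !) (countEven B !) {{ℕ._!≢0 (countOdd B)}} {{ℕ._!≢0 (countEven B)}}) ⟩
  e⁺ (countOdd B) * e⁺ (countEven B)        ≡⟨ cong₂ (λ m n → e⁺ m * e⁺ n) countOdd≡ (length-filter-≟ isEven B) ⟩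
  e⁺ (count (not ∘ isEven) B) * e⁺ (count isEven B) ∎
  where
  countOdd≡ : countOdd B ≡ count (not ∘ isEven) B
  countOdd≡ = trans (length-filter-≟ isOdd B) (count-cong isOdd≡not-isEven B)

cCoeff-∏ : ∀ g → cCoeff g ≡ ∏ g blockCoeff
cCoeff-∏ []      = refl
cCoeff-∏ (B ∷ g) = cong (blockCoeff B *_) (cCoeff-∏ g)

ε : Composition → ℚ
ε = uniform isEven e⁺ ⊛ uniform (not ∘ isEven) e⁺

ε-blockCoeff : ∀ B → ε B ≡ 𝟙 (sortedBy isEven B) * blockCoeff B
ε-blockCoeff B = begin
  ε B
    ≡⟨ uniform-⊛-uniform-not isEven e⁺ e⁺ B ⟩
  𝟙 (sortedBy isEven B) * e⁺ (count isEven B) * e⁺ (count (not ∘ isEven) B)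
    ≡⟨ *-assoc (𝟙 (sortedBy isEven B)) _ _ ⟩
  𝟙 (sortedBy isEven B) * (e⁺ (count isEven B) * e⁺ (count (not ∘ isEven) B))
    ≡⟨ cong (𝟙 (sortedBy isEven B) *_) (trans (*-comm (e⁺ (count isEven B)) _) (sym (blockCoeff-e⁺ B))) ⟩
  𝟙 (sortedBy isEven B) * blockCoeff B ∎

ψ : Composition → ℚ
ψ B = signℚ (length B) * ε (reverse B)

ψ-⊛ : ∀ B → ψ B ≡ (uniform (not ∘ isEven) e⁻ ⊛ uniform isEven e⁻) B
ψ-⊛ B = begin
  signℚ (length B) * (uniform isEven e⁺ ⊛ uniform (not ∘ isEven) e⁺) (reverse B)
    ≡⟨ cong (signℚ (length B) *_) (trans (⊛-reverse (uniform isEven e⁺) (uniform (not ∘ isEven) e⁺) B)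
                                     (⊛-cong (uniform-reverse (not ∘ isEven) e⁺) (uniform-reverse isEven e⁺) B)) ⟩
  signℚ (length B) * (uniform (not ∘ isEven) e⁺ ⊛ uniform isEven e⁺) B
    ≡⟨ sym (⊛-sign (uniform (not ∘ isEven) e⁺) (uniform isEven e⁺) B) ⟩
  ((λ p → signℚ (length p) * uniform (not ∘ isEven) e⁺ p) ⊛ (λ s → signℚ (length s) * uniform isEven e⁺ s)) B
    ≡⟨ ⊛-cong (λ p → sym (uniform-e⁻ (not ∘ isEven) p)) (λ s → sym (uniform-e⁻ isEven s)) B ⟩
  (uniform (not ∘ isEven) e⁻ ⊛ uniform isEven e⁻) B ∎

ε-⊛-ψ : ∀ B → (ε ⊛ ψ) B ≡ δ B
ε-⊛-ψ B = begin
  ((uE ⊛ uO) ⊛ ψ) B            ≡⟨ ⊛-cong {F = uE ⊛ uO} (λ _ → refl) ψ-⊛ B ⟩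
  ((uE ⊛ uO) ⊛ (wO ⊛ wE)) B    ≡⟨ ⊛-assoc uE uO (wO ⊛ wE) B ⟩
  (uE ⊛ (uO ⊛ (wO ⊛ wE))) B    ≡⟨ ⊛-cong {F = uE} (λ _ → refl) cancel B ⟩
  (uE ⊛ wE) B                  ≡⟨ uniform-e⁺-⊛-e⁻ isEven B ⟩
  δ B                          ∎
  where
  uE = uniform isEven e⁺
  uO = uniform (not ∘ isEven) e⁺
  wE = uniform isEven e⁻
  wO = uniform (not ∘ isEven) e⁻
  cancel : ∀ p → (uO ⊛ (wO ⊛ wE)) p ≡ wE p
  cancel p = trans (sym (⊛-assoc uO wO wE p)) (trans (⊛-cong (uniform-e⁺-⊛-e⁻ (not ∘ isEven)) (λ _ → refl) p) (δ-⊛ wE p))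

star-neg-ε : ∀ B → star (λ p → - ε p) B ≡ ψ B
star-neg-ε = star-inverse ε ψ refl ε-⊛-ψ

-- The condition m_o(α) ≤ β

Grouping-head : ∀ {b r g} → Grouping (b ∷ r) g → ∃₂ λ B g₀ → g ≡ (b ∷ B) ∷ g₀
Grouping-head (new {g = g} _)        = [] , g , refl
Grouping-head (join {B = B} {g} _)   = B , g , refl

otEBlocks-head : ∀ b r → ∃₂ λ C ω → otEBlocks (b ∷ r) ≡ (b ∷ C) ∷ ω
otEBlocks-head b []      = [] , [] , refl
otEBlocks-head b (c ∷ r) with otEBlocks (c ∷ r) | otEBlocks-head c r
... | .((c ∷ C) ∷ ω) | C , ω , refl with isOdd b ∧ isEven c
...   | true  = [] , (c ∷ C) ∷ ω , refl
...   | false = c ∷ C , ω , refl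

sortedBy-isEven-∷-∷ : ∀ a b B → sortedBy isEven (a ∷ b ∷ B) ≡ not (isOdd a ∧ isEven b) ∧ sortedBy isEven (b ∷ B)
sortedBy-isEven-∷-∷ a b B =
  trans (sortedBy-∷-∷ isEven a b B) (cong (λ o → not (o ∧ isEven b) ∧ sortedBy isEven (b ∷ B)) (sym (isOdd≡not-isEven a)))

Iset-shift : ∀ a s S → Iset ((a ℕ.+ s) ∷ S) ≡ map (a ℕ.+_) (Iset (s ∷ S))
Iset-shift a s []      = refl
Iset-shift a s (t ∷ S) = cong ((a ℕ.+ s) ∷_) (trans (map-cong (ℕ.+-assoc a s) (Iset (t ∷ S))) (map-∘ (Iset (t ∷ S))))

Iset-sums-new : ∀ a B g → Iset (sums ((a ∷ []) ∷ B ∷ g)) ≡ a ∷ map (a ℕ.+_) (Iset (sums (B ∷ g)))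
Iset-sums-new a B g rewrite ℕ.+-identityʳ a = refl

Iset-sums-join : ∀ a B g → Iset (sums ((a ∷ B) ∷ g)) ≡ map (a ℕ.+_) (Iset (sums (B ∷ g)))
Iset-sums-join a B g = Iset-shift a (sumℕ B) (sums g)

Iset-positive : ∀ b C ω → 0 < b → All (0 <_) (Iset (sums ((b ∷ C) ∷ ω)))
Iset-positive b C []      0<b = []
Iset-positive b C (D ∷ ω) 0<b = 0<s ∷ AllP.map⁺ (All.universal (λ x → ℕ.<-≤-trans 0<s (ℕ.m≤m+n _ x)) _)
  where 0<s = ℕ.<-≤-trans 0<b (ℕ.m≤m+n b (sumℕ C))

private
  _⊆_ : List ℕ → List ℕ → Set
  X ⊆ Y = All (_∈ Y) X

  ∈-shift⁻ : ∀ a {x Y} → a ℕ.+ x ∈ map (a ℕ.+_) Y → x ∈ Y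
  ∈-shift⁻ a {x} m with ∈-map⁻ (a ℕ.+_) m
  ... | y , y∈Y , eq = subst (_∈ _) (sym (ℕ.+-cancelˡ-≡ a x y eq)) y∈Y

  a+x≢a : ∀ a {x} → 0 < x → a ℕ.+ x ≢ a
  a+x≢a a 0<x eq = ℕ.<-irrefl (sym eq) (ℕ.m<m+n a 0<x)

  shift-⊆ : ∀ a {X Y} → map (a ℕ.+_) X ⊆ map (a ℕ.+_) Y ⇔ X ⊆ Y
  shift-⊆ a = mk⇔ (λ h → All.map (∈-shift⁻ a) (AllP.map⁻ h)) (λ h → AllP.map⁺ (All.map (∈-map⁺ (a ℕ.+_)) h))

  shift-⊆-∷ : ∀ a {X Y} → All (0 <_) X → map (a ℕ.+_) X ⊆ (a ∷ map (a ℕ.+_) Y) ⇔ X ⊆ Y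
  shift-⊆-∷ a pos =
    mk⇔ (λ h → All.zipWith drop-a (AllP.map⁻ h , pos)) (λ h → AllP.map⁺ (All.map (there ∘ ∈-map⁺ (a ℕ.+_)) h))
    where
    drop-a : ∀ {x Y} → a ℕ.+ x ∈ a ∷ map (a ℕ.+_) Y × 0 < x → x ∈ Y
    drop-a (here eq , 0<x) = ⊥-elim (a+x≢a a 0<x eq)
    drop-a (there m , _)   = ∈-shift⁻ a m

  T-cong : ∀ {b c} → b ≡ c → T b ⇔ T c
  T-cong refl = mk⇔ (λ t → t) (λ t → t)

  a∉shift : ∀ a {Y} → All (0 <_) Y → a ∉ map (a ℕ.+_) Y
  a∉shift a pos m with ∈-map⁻ (a ℕ.+_) m
  ... | y , y∈Y , eq = a+x≢a a (All.lookup pos y∈Y) (sym eq)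

-- For positive α the partial sums determine the cut positions, so m_o(α) ≤ sums g says that g
-- cuts α after every odd entry followed by an even one.
mo-≤c-⇔ : ∀ {α g} → All (0 <_) α → Grouping α g → mo α ≤c sums g ⇔ T (all (sortedBy isEven) g)
mo-≤c-⇔ _ []                = mk⇔ _ (λ _ → [])
mo-≤c-⇔ _ (new {a} {α = []} []) = ⇔-trans (mk⇔ _ (λ _ → [])) (T-cong (cong (_∧ true) (sym (sortedBy-[x] isEven a))))
mo-≤c-⇔ {a ∷ b ∷ r} (_ ∷ pos@(0<b ∷ _)) (new gr) with Grouping-head gr
... | B , g , refl with otEBlocks (b ∷ r) | otEBlocks-head b r | mo-≤c-⇔ pos gr
...   | .((b ∷ C) ∷ ω) | C , ω , refl | IH =
  ⇔-trans (by-cut (isOdd a ∧ isEven b)) (T-cong (cong (_∧ all (sortedBy isEven) ((b ∷ B) ∷ g)) (sym (sortedBy-[x] isEven a))))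
  where
  by-cut : ∀ c → Iset (sums (if c then (a ∷ []) ∷ (b ∷ C) ∷ ω else (a ∷ b ∷ C) ∷ ω))
                   ⊆ Iset (sums ((a ∷ []) ∷ (b ∷ B) ∷ g))
                 ⇔ T (all (sortedBy isEven) ((b ∷ B) ∷ g))
  by-cut true  rewrite Iset-sums-new a (b ∷ C) ω | Iset-sums-new a (b ∷ B) g =
    ⇔-trans (mk⇔ All.tail (here refl ∷_)) (⇔-trans (shift-⊆-∷ a (Iset-positive b C ω 0<b)) IH)
  by-cut false rewrite Iset-sums-join a (b ∷ C) ω | Iset-sums-new a (b ∷ B) g =
    ⇔-trans (shift-⊆-∷ a (Iset-positive b C ω 0<b)) IH
mo-≤c-⇔ {a ∷ b ∷ r} (_ ∷ pos@(0<b ∷ _)) (join gr) with Grouping-head gr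
... | B , g , refl with otEBlocks (b ∷ r) | otEBlocks-head b r | mo-≤c-⇔ pos gr
...   | .((b ∷ C) ∷ ω) | C , ω , refl | IH =
  ⇔-trans (by-cut (isOdd a ∧ isEven b)) (T-cong (cong (_∧ all (sortedBy isEven) g) (sym (sortedBy-isEven-∷-∷ a b B))))
  where
  by-cut : ∀ c → Iset (sums (if c then (a ∷ []) ∷ (b ∷ C) ∷ ω else (a ∷ b ∷ C) ∷ ω))
                   ⊆ Iset (sums ((a ∷ b ∷ B) ∷ g))
                 ⇔ T ((not c ∧ sortedBy isEven (b ∷ B)) ∧ all (sortedBy isEven) g)
  by-cut true  rewrite Iset-sums-new a (b ∷ C) ω | Iset-sums-join a (b ∷ B) g =
    mk⇔ (λ h → ⊥-elim (a∉shift a (Iset-positive b B g 0<b) (All.head h))) λ ()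
  by-cut false rewrite Iset-sums-join a (b ∷ C) ω | Iset-sums-join a (b ∷ B) g =
    ⇔-trans (shift-⊆ a) IH

mo-≤c?-sorted : ∀ {α g} → All (0 <_) α → Grouping α g → (mo α ≤c? sums g) ≡ all (sortedBy isEven) g
mo-≤c?-sorted {α} {g} pos gr =
  trans (isYes≗does all∈?) (does-⇔ (mo-≤c-⇔ pos gr) all∈? (T? (all (sortedBy isEven) g)))
  where all∈? = All.all? (_∈? Iset (sums g)) (Iset (mo α))

⟪shuffleFn⟫ : ∀ {α} → All (0 <_) α → ∀ X → ⟪ shuffleFn α , X ⟫ ≡ coarseningSum ε X α
⟪shuffleFn⟫ {α} pos X = trans (⟪shuffleFn⟫-groupings α X) (∑-cong-groupings α weight)
  where
  weight : ∀ g → Grouping α g → 𝟙 (mo α ≤c? sums g) * (cCoeff g * X (sums g)) ≡ ∏ g ε * X (sums g)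
  weight g gr = begin
    𝟙 (mo α ≤c? sums g) * (cCoeff g * X (sums g))           ≡⟨ sym (*-assoc (𝟙 (mo α ≤c? sums g)) (cCoeff g) _) ⟩
    𝟙 (mo α ≤c? sums g) * cCoeff g * X (sums g)
      ≡⟨ cong₂ (λ b c → 𝟙 b * c * X (sums g)) (mo-≤c?-sorted pos gr) (cCoeff-∏ g) ⟩
    𝟙 (all (sortedBy isEven) g) * ∏ g blockCoeff * X (sums g)
      ≡⟨ cong (λ b → b * ∏ g blockCoeff * X (sums g)) (𝟙-all (sortedBy isEven) g) ⟩
    ∏[ B ∈ g ] 𝟙 (sortedBy isEven B) * ∏ g blockCoeff * X (sums g)
      ≡⟨ cong (_* X (sums g)) (trans (sym (∏-distrib-* g _ blockCoeff)) (∏-cong g (λ B → sym (ε-blockCoeff B)))) ⟩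
    ∏ g ε * X (sums g)                                        ∎

⟪antipode-shuffleFn⟫ : ∀ {α} → All (0 <_) α → ∀ X →
                       ⟪ antipode (shuffleFn α) , X ⟫ ≡ coarseningSum ψ (X ∘ reverse) α
⟪antipode-shuffleFn⟫ {α} pos X = begin
  ⟪ antipode (shuffleFn α) , X ⟫
    ≡⟨ trans (⟪antipode⟫ (shuffleFn α) X) (⟪shuffleFn⟫ pos _) ⟩
  coarseningSum ε (λ β → ⟪ antipodeM β , X ⟫) α
    ≡⟨ ∑-cong (groupings α) (λ g → trans (cong (∏ g ε *_) (⟪antipodeM⟫ (sums g) X)) (signs g)) ⟩
  ∑[ g ∈ groupings α ] ∏[ B ∈ g ] (- ε B) * (∑[ H ∈ groupings (sums g) ] X (reverse (sums H)))
    ≡⟨ coarseningSum-star (λ B → - ε B) (X ∘ reverse) α ⟩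
  coarseningSum (star (λ B → - ε B)) (X ∘ reverse) α
    ≡⟨ ∑-cong (groupings α) (λ G → cong (_* X (reverse (sums G))) (∏-cong G star-neg-ε)) ⟩
  coarseningSum ψ (X ∘ reverse) α ∎
  where
  S : List (List ℕ) → ℚ
  S g = ∑[ H ∈ groupings (sums g) ] X (reverse (sums H))
  signs : ∀ g → ∏ g ε * (signℚ (length (sums g)) * S g) ≡ ∏[ B ∈ g ] (- ε B) * S g
  signs g = begin
    ∏ g ε * (signℚ (length (sums g)) * S g)   ≡⟨ cong (λ n → ∏ g ε * (signℚ n * S g)) (length-map sumℕ g) ⟩
    ∏ g ε * (signℚ (length g) * S g)
      ≡⟨ solve 3 (λ p s x → p :* (s :* x) := s :* p :* x) refl (∏ g ε) (signℚ (length g)) (S g) ⟩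
    signℚ (length g) * ∏ g ε * S g            ≡⟨ cong (_* S g) (sym (∏-neg g ε)) ⟩
    ∏[ B ∈ g ] (- ε B) * S g                  ∎

signℚ-⟪shuffleFn-reverse⟫ : ∀ {α} → All (0 <_) α → ∀ X →
                            signℚ (length α) * ⟪ shuffleFn (reverse α) , X ⟫ ≡ coarseningSum ψ (X ∘ reverse) α
signℚ-⟪shuffleFn-reverse⟫ {α} pos X = begin
  signℚ (length α) * ⟪ shuffleFn (reverse α) , X ⟫
    ≡⟨ cong (signℚ (length α) *_) (⟪shuffleFn⟫ (All-resp-↭ (↭-sym (↭-reverse α)) pos) X) ⟩
  signℚ (length α) * coarseningSum ε X (reverse α)
    ≡⟨ cong (signℚ (length α) *_) (∑-groupings-reverse α _) ⟩
  signℚ (length α) * (∑[ G ∈ groupings α ] ∏ (reverseᵍ G) ε * X (sums (reverseᵍ G)))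
    ≡⟨ *-distribˡ-∑ (signℚ (length α)) (groupings α) _ ⟩
  ∑[ G ∈ groupings α ] signℚ (length α) * (∏ (reverseᵍ G) ε * X (sums (reverseᵍ G)))
    ≡⟨ ∑-cong-groupings α reversed-block ⟩
  coarseningSum ψ (X ∘ reverse) α ∎
  where
  reversed-block : ∀ G → Grouping α G → signℚ (length α) * (∏ (reverseᵍ G) ε * X (sums (reverseᵍ G)))
                                        ≡ ∏ G ψ * X (reverse (sums G))
  reversed-block G gr = begin
    signℚ (length α) * (∏ (reverseᵍ G) ε * X (sums (reverseᵍ G)))
      ≡⟨ cong₂ (λ β y → signℚ (length β) * (y * X (sums (reverseᵍ G)))) (sym (Grouping-concat gr))
               (trans (∏-reverse (map reverse G) ε) (∏-map reverse G ε)) ⟩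
    signℚ (length (concat G)) * (∏[ B ∈ G ] ε (reverse B) * X (sums (reverseᵍ G)))
      ≡⟨ cong₂ (λ s β → s * (∏[ B ∈ G ] ε (reverse B) * X β)) (signℚ-length-concat G) (sums-reverseᵍ G) ⟩
    ∏[ B ∈ G ] signℚ (length B) * (∏[ B ∈ G ] ε (reverse B) * X (reverse (sums G)))
      ≡⟨ sym (*-assoc (∏[ B ∈ G ] signℚ (length B)) _ _) ⟩
    ∏[ B ∈ G ] signℚ (length B) * ∏[ B ∈ G ] ε (reverse B) * X (reverse (sums G))
      ≡⟨ cong (_* X (reverse (sums G))) (sym (∏-distrib-* G (signℚ ∘ length) (ε ∘ reverse))) ⟩
    ∏ G ψ * X (reverse (sums G)) ∎

mainTheorem4 : (α : Composition) → All (0 <_) α → (γ : Composition) →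
    coeff (antipode (shuffleFn α)) γ ≡ signℚ (length α) * coeff (shuffleFn (reverse α)) γ
mainTheorem4 α pos γ = begin
  coeff (antipode (shuffleFn α)) γ                          ≡⟨ coeff-⟪⟫ (antipode (shuffleFn α)) γ ⟩
  ⟪ antipode (shuffleFn α) , indicator γ ⟫                  ≡⟨ ⟪antipode-shuffleFn⟫ pos (indicator γ) ⟩
  coarseningSum ψ (indicator γ ∘ reverse) α                 ≡⟨ signℚ-⟪shuffleFn-reverse⟫ pos (indicator γ) ⟨
  signℚ (length α) * ⟪ shuffleFn (reverse α) , indicator γ ⟫
    ≡⟨ cong (signℚ (length α) *_) (coeff-⟪⟫ (shuffleFn (reverse α)) γ) ⟨
  signℚ (length α) * coeff (shuffleFn (reverse α)) γ        ∎
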